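{- For all $n\ge 0$ and $0\le k\le n$, $t_{n,k}(y,z)=\widetilde{t}_{n,k}(y,z)$.
   Context: Rooted trees: for a rooted tree $T$ on a totally ordered vertex set, $j$ is a descendant of $i$ if the path from the root to $j$ passes through $i$ (including $j=i$); an edge $ij$ with $j$ a child of $i$ is improper if some descendant of $j$ is lower-numbered than $i$, proper otherwise. Let $\mathcal{T}^{\langle 1;k\rangle}_{n+1}$ be the set of rooted trees on $[n+1]$ in which vertex $1$ has exactly $k$ children, and $t_{n,k}(y,z)=\sum_{T\in\mathcal{T}^{\langle 1;k\rangle}_{n+1}} y^{\mathrm{imprope}(T)} z^{\mathrm{prope}(T)-k}$, where $\mathrm{imprope},\mathrm{prope}$ count improper/proper edges. Partial functional digraphs: a partial functional digraph is a directed graph (loops allowed) in which every vertex has out-degree $0$ or $1$. $\mathbf{PFD}_{n,k}$ is the set of partial functional digraphs on vertex set $[n]$ with exactly $k$ vertices of out-degree $0$. A vertex $k'$ is a predecessor of $j$ if there is a directed path from $k'$ to $j$ (every vertex is a predecessor of itself). An edge $\overrightarrow{ji}$ (from $j$ to $i$) is improper if some predecessor of $j$ (possibly $j$) is $\le i$, and proper otherwise. Define $\widetilde{t}_{n,k}(y,z)=\sum_{G\in\mathbf{PFD}_{n,k}} y^{\mathrm{imprope}(G)} z^{\mathrm{prope}(G)}$. -}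

module Defs where

open import Data.Nat using (ℕ; zero; suc; _≡ᵇ_; _+_)
import Data.Nat as ℕ
open import Data.Bool using (Bool; true; false; _∧_; _∨_; if_then_else_)
open import Data.Fin using (Fin; zero; suc; toℕ)
open import Data.Maybe using (Maybe; just; nothing)
open import Data.List using (List; []; _∷_; [_]; map; concatMap; length; filterᵇ; allFin; foldr)
open import Data.Vec.Functional as VF using ()

allFuns : ∀ {A : Set} (m : ℕ) → List A → List (Fin m → A)
allFuns zero    xs = [ (λ ()) ]
allFuns (suc m) xs = concatMap (λ a → map (λ g → a VF.∷ g) (allFuns m xs)) xs

allMaybeFin : (N : ℕ) → List (Maybe (Fin N))
allMaybeFin N = nothing ∷ map just (allFin N)

-- all "partial maps" Fin N → Maybe (Fin N)
-- (value nothing = out-degree 0 / no parent, value just i = edge to i / parent i)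
PMap : ℕ → Set
PMap N = Fin N → Maybe (Fin N)

allPMaps : (N : ℕ) → List (PMap N)
allPMaps N = allFuns N (allMaybeFin N)

anyFin : (N : ℕ) → (Fin N → Bool) → Bool
anyFin N p = foldr (λ i b → p i ∨ b) false (allFin N)

allFin? : (N : ℕ) → (Fin N → Bool) → Bool
allFin? N p = foldr (λ i b → p i ∧ b) true (allFin N)

countFin : (N : ℕ) → (Fin N → Bool) → ℕ
countFin N p = length (filterᵇ p (allFin N))

eqFin : ∀ {N} → Fin N → Fin N → Bool
eqFin i j = toℕ i ≡ᵇ toℕ j

_<F_ : ∀ {N} → Fin N → Fin N → Bool
i <F j = toℕ i ℕ.<ᵇ toℕ j

_≤F_ : ∀ {N} → Fin N → Fin N → Bool
i ≤F j = toℕ i ℕ.≤ᵇ toℕ j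

isNothing : ∀ {N} → Maybe (Fin N) → Bool
isNothing nothing  = true
isNothing (just _) = false

isJust : ∀ {N} → Maybe (Fin N) → Bool
isJust nothing  = false
isJust (just _) = true

isJustAt : ∀ {N} → Fin N → Maybe (Fin N) → Bool
isJustAt i nothing  = false
isJustAt i (just j) = eqFin i j

iter : ∀ {N} → PMap N → ℕ → Fin N → Maybe (Fin N)
iter f zero    x = just x
iter f (suc s) x with f x
... | nothing = nothing
... | just y  = iter f s y

reachWithin : ∀ {N} → PMap N → ℕ → Fin N → Fin N → Bool
reachWithin f zero    x y = eqFin x y
reachWithin f (suc m) x y = reachWithin f m x y ∨ isJustAt y (iter f (suc m) x)

-- Rooted trees on [n+1]  (vertex 1 = Fin index zero; order = Fin order)
-- A rooted tree is encoded by its parent map p : Fin (n+1) → Maybe (Fin (n+1)),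
-- p j = just i meaning "j is a child of i" (edge ij), p r = nothing for the root.

module _ {n : ℕ} (p : PMap (suc n)) where

  -- exactly one root, and every vertex reaches the root (no cycles):
  -- following parents n+1 times from any vertex leaves the vertex set.
  isRootedTree : Bool
  isRootedTree = (countFin (suc n) (λ j → isNothing (p j)) ≡ᵇ 1)
               ∧ allFin? (suc n) (λ j → isNothing (iter p (suc n) j))

  -- d is a descendant of j : the root-to-d path passes through j,
  -- i.e. j is reached from d by following parents (0 or more steps)
  isDescendant : Fin (suc n) → Fin (suc n) → Bool
  isDescendant d j = reachWithin p (suc n) d j

  -- the edge from the parent of j to j is improper
  -- (only meaningful when p j = just i)
  improperAt : Fin (suc n) → Bool
  improperAt j with p j
  ... | nothing = false
  ... | just i  = anyFin (suc n) (λ d → isDescendant d j ∧ (d <F i))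

  properAt : Fin (suc n) → Bool
  properAt j with p j
  ... | nothing = false
  ... | just i  = if improperAt j then false else true

  treeImprope : ℕ
  treeImprope = countFin (suc n) improperAt

  treePrope : ℕ
  treePrope = countFin (suc n) properAt

  childrenOf1 : ℕ
  childrenOf1 = countFin (suc n) (λ j → isJustAt zero (p j))

-- coefficient of y^a z^b in t_{n,k}(y,z):
-- number of T ∈ 𝒯^{⟨1;k⟩}_{n+1} with imprope(T) = a and prope(T) - k = b
-- (prope(T) - k = b written as prope(T) = b + k, avoiding truncated subtraction;
--  this is the same condition since k ≤ prope(T) always)
tCoeff : (n k a b : ℕ) → ℕ
tCoeff n k a b = length (filterᵇ
  (λ p → isRootedTree p ∧ (childrenOf1 p ≡ᵇ k)
         ∧ (treeImprope p ≡ᵇ a) ∧ (treePrope p ≡ᵇ (b + k)))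
  (allPMaps (suc n)))

-- Partial functional digraphs on [n]: f j = just i encodes the edge j → i,
-- f j = nothing means out-degree 0. Every such f is a PFD.

module _ {n : ℕ} (f : PMap n) where

  -- k' is a predecessor of j : directed path from k' to j (length ≥ 0);
  -- any such path can be shortened to length ≤ n
  isPredecessor : Fin n → Fin n → Bool
  isPredecessor k' j = reachWithin f n k' j

  pfdImproperAt : Fin n → Bool
  pfdImproperAt j with f j
  ... | nothing = false
  ... | just i  = anyFin n (λ k' → isPredecessor k' j ∧ (k' ≤F i))

  pfdProperAt : Fin n → Bool
  pfdProperAt j with f j
  ... | nothing = false
  ... | just i  = if pfdImproperAt j then false else true

  pfdImprope : ℕ
  pfdImprope = countFin n pfdImproperAt

  pfdPrope : ℕ
  pfdPrope = countFin n pfdProperAt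

  outDeg0 : ℕ
  outDeg0 = countFin n (λ j → isNothing (f j))

tTildeCoeff : (n k a b : ℕ) → ℕ
tTildeCoeff n k a b = length (filterᵇ
  (λ f → (outDeg0 f ≡ᵇ k) ∧ (pfdImprope f ≡ᵇ a) ∧ (pfdPrope f ≡ᵇ b))
  (allPMaps n))

-- Vertex 1 is the smallest label, so every edge on the path from vertex 1 to the root (the
-- spine) is improper. Cut the spine at its left-to-right maxima, close each piece into a cycle
-- through its maximum, and delete vertex 1, whose children become the vertices of out-degree 0.
-- In the resulting partial functional digraph every cycle edge is improper (its head is one of
-- its predecessors), an edge off the spine keeps its status because the descendants of a vertex
-- become its predecessors, the proper edges into vertex 1 turn into the k sinks, and the improper
-- edge leaving vertex 1 is traded for the new edge leaving the root. The inverse map cuts every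
-- cycle just before its maximum and chains the cycles, by increasing maximum, above vertex 1.
-- Since functions are only compared pointwise, the counts are transported along the two maps
-- through their representations as vectors.

module Submission where

open import Defs
open import Data.Nat as ℕ using (ℕ; zero; suc; _+_; _*_; _∸_; _≤_; _<_; z≤n; s≤s; _≡ᵇ_)
import Data.Nat.Properties as NP
open import Data.Bool using (Bool; true; false; _∧_; _∨_; not; if_then_else_; T)
open import Data.Bool.Properties using (T?; ∨-zeroʳ; ∨-identityʳ; ∧-zeroʳ)
open import Data.Fin using (Fin; zero; suc; toℕ)
import Data.Fin.Properties as FP
open FP using (toℕ-injective; toℕ<n; pigeonhole)
open import Data.Maybe using (Maybe; just; nothing; fromMaybe)
open import Data.Maybe.Properties using (just-injective)
import Data.Maybe.Properties as Maybe
open import Data.List using (List; []; _∷_; [_]; map; concatMap; length; filterᵇ; _++_; foldr; tabulate; allFin)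
open import Data.List.Properties using (length-++; length-map)
open import Data.List.Membership.Propositional using (_∈_)
open import Data.List.Membership.Propositional.Properties
  using (∈-∃++; ∈-++⁻; ∈-++⁺ˡ; ∈-++⁺ʳ; ∈-map⁻; ∈-map⁺; ∈-filter⁺; ∈-filter⁻; ∈-allFin)
import Data.List.Relation.Unary.All as All
open All using ([]; _∷_)
open import Data.List.Relation.Unary.Any using (here; there)
open import Data.List.Relation.Unary.AllPairs using ([]; _∷_)
open import Data.List.Relation.Unary.Unique.Propositional using (Unique)
import Data.List.Relation.Unary.Unique.Propositional.Properties as Unique
open import Data.List.Relation.Binary.Subset.Propositional using (_⊆_)
open import Data.List.Relation.Binary.Pointwise as Pointwise using (Pointwise; []; _∷_)
open import Data.List.Relation.Binary.Pointwise.Properties using (Pointwise-length)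
open import Data.Vec as Vec using (Vec; []; _∷_; lookup)
open import Data.Vec.Properties using (tabulate∘lookup; lookup∘tabulate; tabulate-cong)
open import Data.Vec.Functional as VF using ()
open import Data.Product using (_×_; _,_; ∃-syntax; proj₁; proj₂)
open import Data.Sum using (_⊎_; inj₁; inj₂)
open import Data.Empty using (⊥; ⊥-elim)
open import Relation.Binary.PropositionalEquality hiding ([_])
open import Relation.Nullary using (yes; no; ¬_; contradiction)
open import Function using (_∘_; id; case_of_)

private variable
  A B : Set
  m : ℕ

T⇒≡true : ∀ {b} → T b → b ≡ true
T⇒≡true {true} _ = refl

≡true⇒T : ∀ {b} → b ≡ true → T b
≡true⇒T refl = _

true≢false : true ≢ false
true≢false ()

indicator : Bool → ℕ
indicator true  = 1
indicator false = 0

∧≡true⁻ : ∀ {a b} → (a ∧ b) ≡ true → a ≡ true × b ≡ true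
∧≡true⁻ {true} {true} _ = refl , refl

∧≡true⁺ : ∀ {a b} → a ≡ true → b ≡ true → (a ∧ b) ≡ true
∧≡true⁺ refl refl = refl

∨≡true⁻ : ∀ {a b} → (a ∨ b) ≡ true → a ≡ true ⊎ b ≡ true
∨≡true⁻ {true} _ = inj₁ refl
∨≡true⁻ {false} e = inj₂ e

≢true⇒≡false : ∀ {a} → a ≢ true → a ≡ false
≢true⇒≡false {true} h = ⊥-elim (h refl)
≢true⇒≡false {false} h = refl

Bool-≡-⇔ : ∀ {a b} → (a ≡ true → b ≡ true) → (b ≡ true → a ≡ true) → a ≡ b
Bool-≡-⇔ {true}  f g = sym (f refl)
Bool-≡-⇔ {false} {true}  f g = g refl
Bool-≡-⇔ {false} {false} f g = refl

if-not : ∀ b → (if b then false else true) ≡ not b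
if-not true  = refl
if-not false = refl

≡ᵇ-+-cancelʳ : ∀ m n k → (m + k ≡ᵇ n + k) ≡ (m ≡ᵇ n)
≡ᵇ-+-cancelʳ m n k = Bool-≡-⇔
  (λ h → T⇒≡true (NP.≡⇒≡ᵇ m n (NP.+-cancelʳ-≡ k m n (NP.≡ᵇ⇒≡ _ _ (≡true⇒T h)))))
  (λ h → T⇒≡true (NP.≡⇒≡ᵇ (m + k) (n + k) (cong (_+ k) (NP.≡ᵇ⇒≡ m n (≡true⇒T h)))))

≡ᵇ∧≡ᵇ∧-+-cancelʳ : ∀ c k i a m n → ((c ≡ᵇ k) ∧ (i ≡ᵇ a) ∧ (m + c ≡ᵇ n + k)) ≡ ((c ≡ᵇ k) ∧ (i ≡ᵇ a) ∧ (m ≡ᵇ n))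
≡ᵇ∧≡ᵇ∧-+-cancelʳ c k i a m n with c ≡ᵇ k in eq
... | false = refl
... | true rewrite NP.≡ᵇ⇒≡ c k (≡true⇒T eq) = cong ((i ≡ᵇ a) ∧_) (≡ᵇ-+-cancelʳ m n k)

just≢nothing : ∀ {a : A} → just a ≢ nothing
just≢nothing ()

Maybe-cases : (m : Maybe A) → m ≡ nothing ⊎ ∃[ y ] (m ≡ just y)
Maybe-cases nothing  = inj₁ refl
Maybe-cases (just y) = inj₂ (y , refl)

isNothing⇒≡nothing : ∀ {N} {m : Maybe (Fin N)} → isNothing m ≡ true → m ≡ nothing
isNothing⇒≡nothing {m = nothing} _ = refl

≡nothing⇒isNothing : ∀ {N} {m : Maybe (Fin N)} → m ≡ nothing → isNothing m ≡ true
≡nothing⇒isNothing refl = refl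

eqFin⇒≡ : ∀ {N} {i j : Fin N} → eqFin i j ≡ true → i ≡ j
eqFin⇒≡ {i = i} {j} e = toℕ-injective (NP.≡ᵇ⇒≡ (toℕ i) (toℕ j) (≡true⇒T e))

eqFin-refl : ∀ {N} (i : Fin N) → eqFin i i ≡ true
eqFin-refl i = T⇒≡true (NP.≡⇒≡ᵇ (toℕ i) (toℕ i) refl)

≢⇒eqFin≡false : ∀ {N} {i j : Fin N} → i ≢ j → eqFin i j ≡ false
≢⇒eqFin≡false ne = ≢true⇒≡false (λ e → ne (eqFin⇒≡ e))

<F⇒< : ∀ {N} {i j : Fin N} → (i <F j) ≡ true → toℕ i < toℕ j
<F⇒< {i = i} {j} e = NP.<ᵇ⇒< (toℕ i) (toℕ j) (≡true⇒T e)

<⇒<F : ∀ {N} {i j : Fin N} → toℕ i < toℕ j → (i <F j) ≡ true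
<⇒<F lt = T⇒≡true (NP.<⇒<ᵇ lt)

<F≡false⇒≥ : ∀ {N} {i j : Fin N} → (i <F j) ≡ false → toℕ j ≤ toℕ i
<F≡false⇒≥ e = NP.≮⇒≥ (λ lt → true≢false (trans (sym (<⇒<F lt)) e))

≤F⇒≤ : ∀ {N} {i j : Fin N} → (i ≤F j) ≡ true → toℕ i ≤ toℕ j
≤F⇒≤ {i = i} {j} e = NP.≤ᵇ⇒≤ (toℕ i) (toℕ j) (≡true⇒T e)

≤⇒≤F : ∀ {N} {i j : Fin N} → toℕ i ≤ toℕ j → (i ≤F j) ≡ true
≤⇒≤F le = T⇒≡true (NP.≤⇒≤ᵇ le)

≢zero⇒suc : ∀ {N} (y : Fin (suc N)) → y ≢ zero → ∃[ i ] (y ≡ suc i)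
≢zero⇒suc zero    y≢0 = contradiction refl y≢0
≢zero⇒suc (suc i) y≢0 = i , refl

≢zero⇒0< : ∀ {N} {y : Fin (suc N)} → y ≢ zero → 0 < toℕ y
≢zero⇒0< {y = zero}  y≢0 = contradiction refl y≢0
≢zero⇒0< {y = suc _} y≢0 = s≤s z≤n

-- Counting, quantifiers and extremal elements over Fin

-- Structurally recursive forms of countFin, anyFin and allFin?, which Defs defines through lists.
private
  count : (N : ℕ) → (Fin N → Bool) → ℕ
  count zero    P = 0
  count (suc N) P = indicator (P zero) + count N (P ∘ suc)

  anyF : (N : ℕ) → (Fin N → Bool) → Bool
  anyF zero    P = false
  anyF (suc N) P = P zero ∨ anyF N (P ∘ suc)

  allF : (N : ℕ) → (Fin N → Bool) → Bool
  allF zero    P = true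
  allF (suc N) P = P zero ∧ allF N (P ∘ suc)

  count-tabulate : ∀ N (f : Fin N → A) (P : A → Bool) → length (filterᵇ P (tabulate f)) ≡ count N (P ∘ f)
  count-tabulate zero    f P = refl
  count-tabulate (suc N) f P with P (f zero)
  ... | true  = cong suc (count-tabulate N (f ∘ suc) P)
  ... | false = count-tabulate N (f ∘ suc) P

  anyF-tabulate : ∀ N (f : Fin N → A) (P : A → Bool) → foldr (λ i b → P i ∨ b) false (tabulate f) ≡ anyF N (P ∘ f)
  anyF-tabulate zero    f P = refl
  anyF-tabulate (suc N) f P = cong (P (f zero) ∨_) (anyF-tabulate N (f ∘ suc) P)

  allF-tabulate : ∀ N (f : Fin N → A) (P : A → Bool) → foldr (λ i b → P i ∧ b) true (tabulate f) ≡ allF N (P ∘ f)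
  allF-tabulate zero    f P = refl
  allF-tabulate (suc N) f P = cong (P (f zero) ∧_) (allF-tabulate N (f ∘ suc) P)

  countFin≡count : ∀ N P → countFin N P ≡ count N P
  countFin≡count N P = count-tabulate N id P

  anyFin≡anyF : ∀ N P → anyFin N P ≡ anyF N P
  anyFin≡anyF N P = anyF-tabulate N id P

  allFin?≡allF : ∀ N P → allFin? N P ≡ allF N P
  allFin?≡allF N P = allF-tabulate N id P

  anyF⁻ : ∀ N P → anyF N P ≡ true → ∃[ i ] P i ≡ true
  anyF⁻ (suc N) P e with P zero in eq
  ... | true  = zero , eq
  ... | false = let (i , h) = anyF⁻ N (P ∘ suc) e in suc i , h

  anyF⁺ : ∀ N P i → P i ≡ true → anyF N P ≡ true
  anyF⁺ (suc N) P zero    e rewrite e = refl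
  anyF⁺ (suc N) P (suc i) e with P zero
  ... | true  = refl
  ... | false = anyF⁺ N (P ∘ suc) i e

  allF⁻ : ∀ N P → allF N P ≡ true → ∀ i → P i ≡ true
  allF⁻ (suc N) P e zero    = proj₁ (∧≡true⁻ e)
  allF⁻ (suc N) P e (suc i) = allF⁻ N (P ∘ suc) (proj₂ (∧≡true⁻ {P zero} e)) i

  allF⁺ : ∀ N P → (∀ i → P i ≡ true) → allF N P ≡ true
  allF⁺ zero    P h = refl
  allF⁺ (suc N) P h = ∧≡true⁺ (h zero) (allF⁺ N (P ∘ suc) (h ∘ suc))

  anyF-cong : ∀ N {P Q} → P ≗ Q → anyF N P ≡ anyF N Q
  anyF-cong zero    h = refl
  anyF-cong (suc N) h = cong₂ _∨_ (h zero) (anyF-cong N (h ∘ suc))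

  allF-cong : ∀ N {P Q} → P ≗ Q → allF N P ≡ allF N Q
  allF-cong zero    h = refl
  allF-cong (suc N) h = cong₂ _∧_ (h zero) (allF-cong N (h ∘ suc))

  count-cong : ∀ N {P Q} → P ≗ Q → count N P ≡ count N Q
  count-cong zero    h = refl
  count-cong (suc N) h = cong₂ _+_ (cong indicator (h zero)) (count-cong N (h ∘ suc))

  count-none : ∀ N P → (∀ i → P i ≡ false) → count N P ≡ 0
  count-none zero    P h = refl
  count-none (suc N) P h rewrite h zero = count-none N (P ∘ suc) (h ∘ suc)

  count-unique : ∀ N P r → P r ≡ true → (∀ x → P x ≡ true → x ≡ r) → count N P ≡ 1
  count-unique (suc N) P zero e u rewrite e =
    cong suc (count-none N (P ∘ suc) (λ i → ≢true⇒≡false (λ t → case u (suc i) t of λ ())))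
  count-unique (suc N) P (suc r) e u with P zero in eq
  ... | true  = case u zero eq of λ ()
  ... | false = count-unique N (P ∘ suc) r e (λ x t → FP.suc-injective (u (suc x) t))

  count-pos : ∀ N P i → P i ≡ true → 1 ≤ count N P
  count-pos (suc N) P zero    e rewrite e = s≤s z≤n
  count-pos (suc N) P (suc i) e = NP.≤-trans (count-pos N (P ∘ suc) i e) (NP.m≤n+m _ (indicator (P zero)))

  count≡1⇒unique : ∀ N P → count N P ≡ 1 → ∀ a b → P a ≡ true → P b ≡ true → a ≡ b
  count≡1⇒unique (suc N) P c zero    zero    ea eb = refl
  count≡1⇒unique (suc N) P c zero    (suc b) ea eb rewrite ea =
    contradiction (NP.suc-injective c) (NP.m<n⇒n≢0 (count-pos N (P ∘ suc) b eb))
  count≡1⇒unique (suc N) P c (suc a) zero    ea eb rewrite eb =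
    contradiction (NP.suc-injective c) (NP.m<n⇒n≢0 (count-pos N (P ∘ suc) a ea))
  count≡1⇒unique (suc N) P c (suc a) (suc b) ea eb with P zero
  ... | true  = contradiction (NP.suc-injective c) (NP.m<n⇒n≢0 (count-pos N (P ∘ suc) a ea))
  ... | false = cong suc (count≡1⇒unique N (P ∘ suc) c a b ea eb)

  count-∨ : ∀ N P Q → (∀ i → (P i ∧ Q i) ≡ false) → count N (λ i → P i ∨ Q i) ≡ count N P + count N Q
  count-∨ zero    P Q h = refl
  count-∨ (suc N) P Q h with P zero | Q zero | h zero
  ... | true  | false | _ = cong suc (count-∨ N (P ∘ suc) (Q ∘ suc) (h ∘ suc))
  ... | false | true  | _ = trans (cong suc (count-∨ N (P ∘ suc) (Q ∘ suc) (h ∘ suc))) (sym (NP.+-suc _ _))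
  ... | false | false | _ = count-∨ N (P ∘ suc) (Q ∘ suc) (h ∘ suc)

  count-flip : ∀ N P Q r → (∀ j → j ≢ r → P j ≡ Q j) → P r ≡ false → Q r ≡ true → count N Q ≡ suc (count N P)
  count-flip (suc N) P Q zero h ea eb rewrite ea | eb =
    cong suc (sym (count-cong N (λ i → h (suc i) (λ ()))))
  count-flip (suc N) P Q (suc r) h ea eb rewrite h zero (λ ()) =
    trans (cong (indicator (Q zero) +_) (count-flip N (P ∘ suc) (Q ∘ suc) r (λ j j≢r → h (suc j) (j≢r ∘ FP.suc-injective)) ea eb))
          (NP.+-suc (indicator (Q zero)) _)

anyFin⁻ : ∀ N P → anyFin N P ≡ true → ∃[ i ] P i ≡ true
anyFin⁻ N P e = anyF⁻ N P (trans (sym (anyFin≡anyF N P)) e)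

anyFin⁺ : ∀ N P i → P i ≡ true → anyFin N P ≡ true
anyFin⁺ N P i e = trans (anyFin≡anyF N P) (anyF⁺ N P i e)

anyFin-none : ∀ N P → (∀ i → P i ≡ false) → anyFin N P ≡ false
anyFin-none N P h = ≢true⇒≡false (λ e → let (i , x) = anyFin⁻ N P e in true≢false (trans (sym x) (h i)))

anyFin-cong : ∀ N {P Q} → P ≗ Q → anyFin N P ≡ anyFin N Q
anyFin-cong N {P} {Q} h = trans (anyFin≡anyF N P) (trans (anyF-cong N h) (sym (anyFin≡anyF N Q)))

allFin?⁻ : ∀ N P → allFin? N P ≡ true → ∀ i → P i ≡ true
allFin?⁻ N P e = allF⁻ N P (trans (sym (allFin?≡allF N P)) e)

allFin?⁺ : ∀ N P → (∀ i → P i ≡ true) → allFin? N P ≡ true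
allFin?⁺ N P h = trans (allFin?≡allF N P) (allF⁺ N P h)

allFin?-cong : ∀ N {P Q} → P ≗ Q → allFin? N P ≡ allFin? N Q
allFin?-cong N {P} {Q} h = trans (allFin?≡allF N P) (trans (allF-cong N h) (sym (allFin?≡allF N Q)))

countFin-suc : ∀ N P → countFin (suc N) P ≡ indicator (P zero) + countFin N (P ∘ suc)
countFin-suc N P = trans (countFin≡count (suc N) P) (cong (indicator (P zero) +_) (sym (countFin≡count N (P ∘ suc))))

countFin-cong : ∀ N {P Q} → P ≗ Q → countFin N P ≡ countFin N Q
countFin-cong N {P} {Q} h = trans (countFin≡count N P) (trans (count-cong N h) (sym (countFin≡count N Q)))

countFin-unique : ∀ N P r → P r ≡ true → (∀ x → P x ≡ true → x ≡ r) → countFin N P ≡ 1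
countFin-unique N P r e u = trans (countFin≡count N P) (count-unique N P r e u)

countFin≡1⇒unique : ∀ N P → countFin N P ≡ 1 → ∀ a b → P a ≡ true → P b ≡ true → a ≡ b
countFin≡1⇒unique N P c = count≡1⇒unique N P (trans (sym (countFin≡count N P)) c)

countFin-∨ : ∀ N P Q → (∀ i → (P i ∧ Q i) ≡ false) → countFin N (λ i → P i ∨ Q i) ≡ countFin N P + countFin N Q
countFin-∨ N P Q h = trans (countFin≡count N _)
  (trans (count-∨ N P Q h) (sym (cong₂ _+_ (countFin≡count N P) (countFin≡count N Q))))

countFin-flip : ∀ N P Q r → (∀ j → j ≢ r → P j ≡ Q j) → P r ≡ false → Q r ≡ true →
  countFin N Q ≡ suc (countFin N P)
countFin-flip N P Q r h ea eb = trans (countFin≡count N Q)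
  (trans (count-flip N P Q r h ea eb) (cong suc (sym (countFin≡count N P))))

greatest : (N : ℕ) → (Fin N → Bool) → Maybe (Fin N)
greatest zero    P = nothing
greatest (suc N) P with greatest N (P ∘ suc)
... | just m  = just (suc m)
... | nothing = if P zero then just zero else nothing

least : (N : ℕ) → (Fin N → Bool) → Maybe (Fin N)
least zero    P = nothing
least (suc N) P with P zero
... | true  = just zero
... | false with least N (P ∘ suc)
...   | just m  = just (suc m)
...   | nothing = nothing

greatest-nothing : ∀ N P → greatest N P ≡ nothing → ∀ z → P z ≡ false
greatest-nothing (suc N) P e z with greatest N (P ∘ suc) in eq
greatest-nothing (suc N) P () z       | just _
greatest-nothing (suc N) P e  z       | nothing with P zero in ez
greatest-nothing (suc N) P () z       | nothing | true
greatest-nothing (suc N) P e  zero    | nothing | false = ez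
greatest-nothing (suc N) P e  (suc z) | nothing | false = greatest-nothing N (P ∘ suc) eq z

greatest-just : ∀ N P m → greatest N P ≡ just m → P m ≡ true × (∀ z → P z ≡ true → toℕ z ≤ toℕ m)
greatest-just (suc N) P m e with greatest N (P ∘ suc) in eq
greatest-just (suc N) P .(suc m′) refl | just m′ =
  let (Pm , max) = greatest-just N (P ∘ suc) m′ eq in
  Pm , λ { zero _ → z≤n ; (suc z) Pz → s≤s (max z Pz) }
greatest-just (suc N) P m e | nothing with P zero in ez
greatest-just (suc N) P .zero refl | nothing | true =
  ez , λ { zero _ → z≤n ; (suc z) Pz → contradiction (trans (sym Pz) (greatest-nothing N (P ∘ suc) eq z)) λ () }

least-nothing : ∀ N P → least N P ≡ nothing → ∀ z → P z ≡ false
least-nothing (suc N) P e z with P zero in ez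
least-nothing (suc N) P () z       | true
least-nothing (suc N) P e  z       | false with least N (P ∘ suc) in eq
least-nothing (suc N) P () z       | false | just _
least-nothing (suc N) P e  zero    | false | nothing = ez
least-nothing (suc N) P e  (suc z) | false | nothing = least-nothing N (P ∘ suc) eq z

least-just : ∀ N P m → least N P ≡ just m → P m ≡ true × (∀ z → P z ≡ true → toℕ m ≤ toℕ z)
least-just (suc N) P m e with P zero in ez
least-just (suc N) P .zero refl | true = ez , λ _ _ → z≤n
least-just (suc N) P m e | false with least N (P ∘ suc) in eq
least-just (suc N) P .(suc m′) refl | false | just m′ =
  let (Pm , min) = least-just N (P ∘ suc) m′ eq in
  Pm , λ { zero Pz → contradiction (trans (sym Pz) ez) λ () ; (suc z) Pz → s≤s (min z Pz) }

least-char : ∀ N P m → P m ≡ true → (∀ z → P z ≡ true → toℕ m ≤ toℕ z) → least N P ≡ just m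
least-char N P m Pm min with least N P in eq
... | just m′ = let (Pm′ , min′) = least-just N P m′ eq in
  cong just (toℕ-injective (NP.≤-antisym (min′ m Pm) (min m′ Pm′)))
... | nothing = contradiction (trans (sym Pm) (least-nothing N P eq m)) λ ()

least-none : ∀ N P → (∀ z → P z ≡ false) → least N P ≡ nothing
least-none N P h with least N P in eq
... | just m  = contradiction (trans (sym (proj₁ (least-just N P m eq))) (h m)) λ ()
... | nothing = refl

greatest-cong : ∀ N {P Q} → P ≗ Q → greatest N P ≡ greatest N Q
greatest-cong zero    h = refl
greatest-cong (suc N) {P} {Q} h with greatest N (P ∘ suc) | greatest N (Q ∘ suc) | greatest-cong N (h ∘ suc)
... | just m  | _ | refl = refl
... | nothing | _ | refl rewrite h zero = refl

least-cong : ∀ N {P Q} → P ≗ Q → least N P ≡ least N Q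
least-cong zero    h = refl
least-cong (suc N) {P} {Q} h with P zero | Q zero | h zero
... | true  | _ | refl = refl
... | false | _ | refl with least N (P ∘ suc) | least N (Q ∘ suc) | least-cong N (h ∘ suc)
...   | just m  | _ | refl = refl
...   | nothing | _ | refl = refl

-- Iterating partial maps

module _ {N : ℕ} (g : PMap N) where

  Reach : Fin N → Fin N → Set
  Reach x y = ∃[ s ] iter g s x ≡ just y

  iter-suc-just : ∀ s x y → g x ≡ just y → iter g (suc s) x ≡ iter g s y
  iter-suc-just s x y e with g x
  iter-suc-just s x y refl | just .y = refl

  iter-+ : ∀ a b {x y} → iter g a x ≡ just y → iter g (a + b) x ≡ iter g b y
  iter-+ zero b refl = refl
  iter-+ (suc a) b {x} e with g x
  ... | nothing = ⊥-elim (just≢nothing (sym e))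
  ... | just z = iter-+ a b e

  iter-+-nothing : ∀ a b {x} → iter g a x ≡ nothing → iter g (a + b) x ≡ nothing
  iter-+-nothing zero b ()
  iter-+-nothing (suc a) b {x} e with g x
  ... | nothing = refl
  ... | just z = iter-+-nothing a b e

  iter-snoc : ∀ s {x y z} → iter g s x ≡ just y → g y ≡ just z → iter g (suc s) x ≡ just z
  iter-snoc s {x} {y} {z} e e' =
    trans (cong (λ t → iter g t x) (sym (NP.+-comm s 1)))
          (trans (iter-+ s 1 e) (trans (iter-suc-just 0 y z e') refl))

  reach-refl : ∀ x → Reach x x
  reach-refl x = 0 , refl

  reach-step : ∀ {x y z} → g x ≡ just y → Reach y z → Reach x z
  reach-step {x} {y} e (s , h) = suc s , trans (iter-suc-just s x y e) h

  reach-edge : ∀ {x y} → g x ≡ just y → Reach x y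
  reach-edge e = reach-step e (reach-refl _)

  reach-trans : ∀ {x y z} → Reach x y → Reach y z → Reach x z
  reach-trans (a , h) (b , h') = a + b , trans (iter-+ a b h) h'

  reach-uncons : ∀ {x y} → Reach x y → x ≡ y ⊎ ∃[ z ] (g x ≡ just z × Reach z y)
  reach-uncons (zero , refl) = inj₁ refl
  reach-uncons {x} (suc s , h) with g x in eq
  ... | nothing = ⊥-elim (just≢nothing (sym h))
  ... | just z = inj₂ (z , refl , s , h)

  reach-from-sink : ∀ {x y} → g x ≡ nothing → Reach x y → x ≡ y
  reach-from-sink e r with reach-uncons r
  ... | inj₁ eq = eq
  ... | inj₂ (z , e' , _) = ⊥-elim (just≢nothing (trans (sym e') e))

  reach-comparable : ∀ {x a b} → Reach x a → Reach x b → Reach a b ⊎ Reach b a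
  reach-comparable {x} (s , ha) (t , hb) with NP.≤-total s t
  ... | inj₁ s≤t = inj₁ (t ∸ s , trans (sym (iter-+ s (t ∸ s) ha))
                                   (trans (cong (λ u → iter g u x) (NP.m+[n∸m]≡n s≤t)) hb))
  ... | inj₂ t≤s = inj₂ (s ∸ t , trans (sym (iter-+ t (s ∸ t) hb))
                                   (trans (cong (λ u → iter g u x) (NP.m+[n∸m]≡n t≤s)) ha))

  walk : Fin N → ℕ → Fin N
  walk x zero = x
  walk x (suc i) with g x
  ... | nothing = x
  ... | just z = walk z i

  iter-walk : ∀ s i {x y} → iter g s x ≡ just y → i ≤ s → iter g i x ≡ just (walk x i)
  iter-walk s zero e le = refl
  iter-walk (suc s) (suc i) {x} e (s≤s le) with g x
  ... | nothing = ⊥-elim (just≢nothing (sym e))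
  ... | just z = iter-walk s i e le

  -- A walk of N or more steps repeats a vertex (pigeonhole), and the loop in between can be cut out.
  shorten : ∀ fuel s {x y} → s ≤ fuel → iter g s x ≡ just y → ∃[ t ] (t < N × iter g t x ≡ just y)
  shorten zero .zero {x} z≤n e = 0 , NP.≤-trans (s≤s z≤n) (toℕ<n x) , e
  shorten (suc fuel) s {x} {y} le e with s ℕ.<? N
  ... | yes lt = s , lt , e
  ... | no nlt =
    let (i , j , i<j , fe) = pigeonhole {m = N} {n = suc s} (s≤s (NP.≮⇒≥ nlt)) (λ k → walk x (toℕ k))
        i' = toℕ i
        j' = toℕ j
        j≤s : j' ≤ s
        j≤s = NP.≤-pred (toℕ<n j)
        hi : iter g i' x ≡ just (walk x j')
        hi = trans (iter-walk s i' e (NP.<⇒≤ (NP.<-≤-trans i<j j≤s))) (cong just fe)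
        hj : iter g j' x ≡ just (walk x j')
        hj = iter-walk s j' e j≤s
        hs : iter g (s ∸ j') (walk x j') ≡ just y
        hs = trans (sym (iter-+ j' (s ∸ j') hj)) (trans (cong (λ u → iter g u x) (NP.m+[n∸m]≡n j≤s)) e)
        h' : iter g (i' + (s ∸ j')) x ≡ just y
        h' = trans (iter-+ i' (s ∸ j') hi) hs
        lt' : i' + (s ∸ j') < s
        lt' = subst (i' + (s ∸ j') <_) (NP.m+[n∸m]≡n j≤s) (NP.+-monoˡ-< (s ∸ j') i<j)
    in shorten fuel (i' + (s ∸ j')) (NP.≤-pred (NP.<-≤-trans lt' le)) h'

  reachWithin-sound : ∀ m {x y} → reachWithin g m x y ≡ true → Reach x y
  reachWithin-sound zero e = 0 , cong just (eqFin⇒≡ e)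
  reachWithin-sound (suc m) {x} {y} e with ∨≡true⁻ {reachWithin g m x y} e
  ... | inj₁ e1 = reachWithin-sound m e1
  ... | inj₂ e2 with iter g (suc m) x in eq
  ... | just w = suc m , trans eq (cong just (sym (eqFin⇒≡ e2)))
  ... | nothing = ⊥-elim (true≢false (sym e2))

  reachWithin-complete : ∀ m s {x y} → s ≤ m → iter g s x ≡ just y → reachWithin g m x y ≡ true
  reachWithin-complete zero zero {x} z≤n refl = eqFin-refl x
  reachWithin-complete (suc m) s {x} {y} le e with s ℕ.≤? m
  ... | yes le' rewrite reachWithin-complete m s le' e = refl
  ... | no nle with NP.≤-antisym le (NP.≰⇒> nle)
  ... | refl rewrite e | eqFin-refl y = ∨-zeroʳ (reachWithin g m x y)

  Reach⇒reachWithin : ∀ m {x y} → N ≤ suc m → Reach x y → reachWithin g m x y ≡ true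
  Reach⇒reachWithin m le (s , e) with shorten s s NP.≤-refl e
  ... | t , lt , e' = reachWithin-complete m t (NP.≤-pred (NP.≤-trans lt le)) e'

  reaches? : Fin N → Fin N → Bool
  reaches? = reachWithin g N

  reaches?⇒Reach : ∀ {x y} → reaches? x y ≡ true → Reach x y
  reaches?⇒Reach = reachWithin-sound N

  Reach⇒reaches? : ∀ {x y} → Reach x y → reaches? x y ≡ true
  Reach⇒reaches? = Reach⇒reachWithin N (NP.n≤1+n N)

  iter-periodic : ∀ L {x} → iter g L x ≡ just x → ∀ k → iter g (k * L) x ≡ just x
  iter-periodic L e zero = refl
  iter-periodic L {x} e (suc k) = trans (iter-+ L (k * L) e) (iter-periodic L e k)

  iter-nothing⇒sink : ∀ s {x} → iter g s x ≡ nothing → ∃[ r ] (g r ≡ nothing × Reach x r)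
  iter-nothing⇒sink zero ()
  iter-nothing⇒sink (suc s) {x} e with g x in eq
  ... | nothing = x , eq , reach-refl x
  ... | just z = let (r , a , b) = iter-nothing⇒sink s e in r , a , reach-step eq b

  iter-nothing⇒no-cycle : ∀ {x} s → iter g N x ≡ nothing → iter g (suc s) x ≡ just x → ⊥
  iter-nothing⇒no-cycle {x} s eN ec = just≢nothing (trans (sym (iter-periodic (suc s) ec N)) e')
    where
    le : N ≤ N * suc s
    le = NP.m≤m*n N (suc s)
    e' : iter g (N * suc s) x ≡ nothing
    e' = trans (cong (λ t → iter g t x) (sym (NP.m+[n∸m]≡n le))) (iter-+-nothing N (N * suc s ∸ N) eN)

  iter-unsnoc : ∀ s {x w} → iter g (suc s) x ≡ just w → ∃[ z ] (iter g s x ≡ just z × g z ≡ just w)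
  iter-unsnoc zero {x} e with g x in eq
  ... | just z = x , refl , trans eq e
  ... | nothing = ⊥-elim (just≢nothing (sym e))
  iter-unsnoc (suc s) {x} e with g x in eq
  ... | just z = iter-unsnoc s e
  ... | nothing = ⊥-elim (just≢nothing (sym e))

  reach-within-period : ∀ L {v y} → iter g (suc L) v ≡ just v → Reach v y → ∃[ j ] (j ≤ L × iter g j v ≡ just y)
  reach-within-period L {v} {y} ev (s , e) = go s s NP.≤-refl e
    where
    go : ∀ fuel s → s ≤ fuel → iter g s v ≡ just y → ∃[ j ] (j ≤ L × iter g j v ≡ just y)
    go fuel s le e with s ℕ.≤? L
    ... | yes le' = s , le' , e
    go zero zero le e | no nle = ⊥-elim (nle z≤n)
    go (suc fuel) s le e | no nle =
      let L<s = NP.≰⇒> nle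
          eq : suc L + (s ∸ suc L) ≡ s
          eq = NP.m+[n∸m]≡n L<s
          e' : iter g (s ∸ suc L) v ≡ just y
          e' = trans (sym (iter-+ (suc L) (s ∸ suc L) ev)) (trans (cong (λ t → iter g t v) eq) e)
      in go fuel (s ∸ suc L) (NP.≤-pred (NP.≤-trans (NP.∸-monoʳ-< {m = s} {n = suc L} {o = 0} (s≤s z≤n) L<s) le)) e'

  iter-just⇒cycle : ∀ {x y} → iter g N x ≡ just y → ∃[ v ] ∃[ t ] (iter g (suc t) v ≡ just v)
  iter-just⇒cycle {x} {y} e =
    let (i , j , i<j , fe) = pigeonhole {m = N} {n = suc N} NP.≤-refl (λ k → walk x (toℕ k))
        i' = toℕ i
        j' = toℕ j
        j≤N = NP.≤-pred (toℕ<n j)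
        hi = iter-walk N i' e (NP.<⇒≤ (NP.<-≤-trans i<j j≤N))
        hj = iter-walk N j' e j≤N
        eq : i' + (j' ∸ i') ≡ j'
        eq = NP.m+[n∸m]≡n (NP.<⇒≤ i<j)
        hv : iter g (j' ∸ i') (walk x i') ≡ just (walk x i')
        hv = trans (sym (iter-+ i' (j' ∸ i') hi)) (trans (cong (λ t → iter g t x) eq) (trans hj (cong just (sym fe))))
        pos : j' ∸ i' ≡ suc (j' ∸ suc i')
        pos = NP.+-∸-assoc 1 i<j
    in walk x i' , (j' ∸ suc i') , subst (λ t → iter g t (walk x i') ≡ just (walk x i')) pos hv

iter-cong : ∀ {N} (g h : PMap N) → (∀ i → g i ≡ h i) → ∀ s x → iter g s x ≡ iter h s x
iter-cong g h eq zero x = refl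
iter-cong g h eq (suc s) x with g x | h x | eq x
... | nothing | .nothing | refl = refl
... | just z | .(just z) | refl = iter-cong g h eq s z

reachWithin-cong : ∀ {N} (g h : PMap N) → (∀ i → g i ≡ h i) → ∀ m x y → reachWithin g m x y ≡ reachWithin h m x y
reachWithin-cong g h eq zero x y = refl
reachWithin-cong g h eq (suc m) x y = cong₂ _∨_ (reachWithin-cong g h eq m x y) (cong (isJustAt y) (iter-cong g h eq (suc m) x))

reach-cong : ∀ {N} (g h : PMap N) → (∀ i → g i ≡ h i) → ∀ {x y} → Reach g x y → Reach h x y
reach-cong g h eq {x} (s , e) = s , trans (sym (iter-cong g h eq s x)) e

reach-transfer-along : ∀ {N} (g h : PMap N) {x y} →
  (∀ u → Reach g x u → Reach g u y → u ≢ y → g u ≡ h u) → Reach g x y → Reach h x y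
reach-transfer-along g h {x₀} {y} agree (s , e) = go s (reach-refl g x₀) e
  where
  go : ∀ s {x} → Reach g x₀ x → iter g s x ≡ just y → Reach h x y
  go zero r refl = reach-refl h _
  go (suc s) {x} r e with g x in eq
  ... | nothing = ⊥-elim (just≢nothing (sym e))
  ... | just z with x FP.≟ y
  ...   | yes refl = reach-refl h x
  ...   | no x≢y = reach-step h (trans (sym (agree x r (suc s , trans (iter-suc-just g s x z eq) e) x≢y)) eq)
                                (go s (reach-trans g r (reach-edge g eq)) e)

reach-transfer : ∀ {N} (g h : PMap N) {x y} → (∀ u → Reach g u y → u ≢ y → g u ≡ h u) → Reach g x y → Reach h x y
reach-transfer g h agree = reach-transfer-along g h (λ u _ → agree u)

shiftTarget : ∀ {n} → Maybe (Fin n) → Maybe (Fin (suc n))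
shiftTarget nothing  = just zero
shiftTarget (just i) = just (suc i)

unshiftTarget : ∀ {n} → Maybe (Fin (suc n)) → Maybe (Fin n)
unshiftTarget (just zero)    = nothing
unshiftTarget (just (suc i)) = just i
unshiftTarget nothing        = nothing

-- Vertex 1 is Fin index zero: shift adds it as the common target of all sinks, unshift deletes it.
shift : ∀ {n} → PMap n → PMap (suc n)
shift f zero    = nothing
shift f (suc j) = shiftTarget (f j)

unshift : ∀ {n} → PMap (suc n) → PMap n
unshift G j = unshiftTarget (G (suc j))

unshift-shift : ∀ {n} (f : PMap n) → unshift (shift f) ≗ f
unshift-shift f j with f j
... | nothing = refl
... | just i  = refl

shift-unshift : ∀ {n} (G : PMap (suc n)) {j y} → G (suc j) ≡ just y → shift (unshift G) (suc j) ≡ just y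
shift-unshift G {j} {zero}  e rewrite e = refl
shift-unshift G {j} {suc i} e rewrite e = refl

unshift-cong : ∀ {n} (G H : PMap (suc n)) → G ≗ H → unshift G ≗ unshift H
unshift-cong G H G≗H j = cong unshiftTarget (G≗H (suc j))

reach-unshift⁻ : ∀ {n} (G : PMap (suc n)) {a b} → Reach (unshift G) a b → Reach G (suc a) (suc b)
reach-unshift⁻ G (s , e) = go s e
  where
  go : ∀ s {a b} → iter (unshift G) s a ≡ just b → Reach G (suc a) (suc b)
  go zero refl = reach-refl G _
  go (suc s) {a} e with G (suc a) in eq
  ... | just zero = ⊥-elim (just≢nothing (sym e))
  ... | just (suc i) = reach-step G eq (go s e)
  ... | nothing = ⊥-elim (just≢nothing (sym e))

reach-unshift⁺ : ∀ {n} (G : PMap (suc n)) → G zero ≡ nothing → ∀ {a b} → Reach G (suc a) (suc b) → Reach (unshift G) a b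
reach-unshift⁺ {n} G G0 (s , e) = go s e
  where
  go : ∀ s {a b} → iter G s (suc a) ≡ just (suc b) → Reach (unshift G) a b
  go zero refl = reach-refl (unshift G) _
  go (suc s) {a} {b} e with G (suc a) in eq
  ... | nothing = ⊥-elim (just≢nothing (sym e))
  ... | just zero = case reach-from-sink G G0 (s , e) of λ ()
  ... | just (suc i) = reach-step (unshift G) (cong unshiftTarget eq) (go s e)

reach-invariant : ∀ {N} (g : PMap N) (I : Fin N → Set) → (∀ {u v} → I u → g u ≡ just v → I v) → ∀ {x z} → I x → Reach g x z → I z
reach-invariant g I step ix (s , e) = go s ix e
  where
  go : ∀ s {x z} → I x → iter g s x ≡ just z → I z
  go zero ix refl = ix
  go (suc s) {x} ix e with g x in eq
  ... | nothing = ⊥-elim (just≢nothing (sym e))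
  ... | just w = go s (step ix eq) e

-- Rooted trees and their edge statistics

module RootedTree (n : ℕ) (p : PMap (suc n)) (hT : isRootedTree p ≡ true) where

  N = suc n

  one-root : countFin N (λ j → isNothing (p j)) ≡ 1
  one-root = NP.≡ᵇ⇒≡ _ 1 (≡true⇒T (proj₁ (∧≡true⁻ hT)))

  iter-escapes : ∀ x → iter p N x ≡ nothing
  iter-escapes = isNothing⇒≡nothing ∘ allFin?⁻ N (λ j → isNothing (iter p N j)) (proj₂ (∧≡true⁻ {countFin N (λ j → isNothing (p j)) ≡ᵇ 1} hT))

  no-cycle : ∀ {x} s → iter p (suc s) x ≡ just x → ⊥
  no-cycle s = iter-nothing⇒no-cycle p s (iter-escapes _)

  acyclic : ∀ {x y} → p x ≡ just y → Reach p y x → ⊥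
  acyclic {x} {y} e (s , h) = no-cycle s (trans (iter-suc-just p s x y e) h)

  no-loop : ∀ {x} → p x ≡ just x → ⊥
  no-loop e = acyclic e (reach-refl p _)

  reach-antisym : ∀ {a b} → Reach p a b → Reach p b a → a ≡ b
  reach-antisym r r' with reach-uncons p r
  ... | inj₁ eq = eq
  ... | inj₂ (z , e , r2) = ⊥-elim (acyclic e (reach-trans p r2 r'))

  root-unique : ∀ {a b} → p a ≡ nothing → p b ≡ nothing → a ≡ b
  root-unique ea eb = countFin≡1⇒unique N _ one-root _ _ (≡nothing⇒isNothing ea) (≡nothing⇒isNothing eb)

  reach-root : ∀ x → ∃[ r ] (p r ≡ nothing × Reach p x r)
  reach-root x = iter-nothing⇒sink p N (iter-escapes x)

rootedTree-intro : ∀ {n} (p : PMap (suc n)) r → p r ≡ nothing → (∀ x → p x ≡ nothing → x ≡ r) →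
  (∀ x → iter p (suc n) x ≡ nothing) → isRootedTree p ≡ true
rootedTree-intro {n} p r pr≡nothing root-unique escapes = ∧≡true⁺
  (T⇒≡true (NP.≡⇒≡ᵇ _ 1 (countFin-unique (suc n) (isNothing ∘ p) r (≡nothing⇒isNothing pr≡nothing)
    (λ x → root-unique x ∘ isNothing⇒≡nothing))))
  (allFin?⁺ (suc n) _ (≡nothing⇒isNothing ∘ escapes))

module _ {n : ℕ} (p : PMap (suc n)) where
  improperAt-root : ∀ {x} → p x ≡ nothing → improperAt p x ≡ false
  improperAt-root {x} e with p x
  improperAt-root {x} refl | .nothing = refl

  improperAt-child : ∀ {x i} → p x ≡ just i → improperAt p x ≡ anyFin (suc n) (λ d → isDescendant p d x ∧ (d <F i))
  improperAt-child {x} e with p x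
  improperAt-child {x} refl | .(just _) = refl

  properAt-root : ∀ {x} → p x ≡ nothing → properAt p x ≡ false
  properAt-root {x} e with p x
  properAt-root {x} refl | .nothing = refl

  private
    properAt-child′ : ∀ {x i} → p x ≡ just i → properAt p x ≡ (if improperAt p x then false else true)
    properAt-child′ {x} {i} e with p x in eq
    properAt-child′ {x} {i} refl | just .i rewrite eq = refl

  properAt-child : ∀ {x i} → p x ≡ just i → properAt p x ≡ not (improperAt p x)
  properAt-child e = trans (properAt-child′ e) (if-not _)

module _ {n : ℕ} (f : PMap n) where
  pfdImproperAt-sink : ∀ {x} → f x ≡ nothing → pfdImproperAt f x ≡ false
  pfdImproperAt-sink {x} e with f x
  pfdImproperAt-sink {x} refl | .nothing = refl

  pfdImproperAt-edge : ∀ {x i} → f x ≡ just i → pfdImproperAt f x ≡ anyFin n (λ k → isPredecessor f k x ∧ (k ≤F i))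
  pfdImproperAt-edge {x} e with f x
  pfdImproperAt-edge {x} refl | .(just _) = refl

  pfdProperAt-sink : ∀ {x} → f x ≡ nothing → pfdProperAt f x ≡ false
  pfdProperAt-sink {x} e with f x
  pfdProperAt-sink {x} refl | .nothing = refl

  private
    pfdProperAt-edge′ : ∀ {x i} → f x ≡ just i → pfdProperAt f x ≡ (if pfdImproperAt f x then false else true)
    pfdProperAt-edge′ {x} {i} e with f x in eq
    pfdProperAt-edge′ {x} {i} refl | just .i rewrite eq = refl

  pfdProperAt-edge : ∀ {x i} → f x ≡ just i → pfdProperAt f x ≡ not (pfdImproperAt f x)
  pfdProperAt-edge e = trans (pfdProperAt-edge′ e) (if-not _)

-- From rooted trees to partial functional digraphs

isNotVertex1 : ∀ {N} → Fin (suc N) → Bool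
isNotVertex1 x = not (eqFin x zero)

isNotVertex1⇒≢ : ∀ {N} {x : Fin (suc N)} → isNotVertex1 x ≡ true → x ≢ zero
isNotVertex1⇒≢ {x = zero} () refl
isNotVertex1⇒≢ {x = suc x} e ()

≢⇒isNotVertex1 : ∀ {N} {x : Fin (suc N)} → x ≢ zero → isNotVertex1 x ≡ true
≢⇒isNotVertex1 {x = zero} ne = ⊥-elim (ne refl)
≢⇒isNotVertex1 {x = suc x} ne = refl

parentOrMax : ∀ {N} → Maybe (Fin N) → Fin N → Fin N
parentOrMax (just y) m = if y <F m then y else m
parentOrMax nothing  m = m

parentOrMax-< : ∀ {N} {y m : Fin N} → toℕ y < toℕ m → parentOrMax (just y) m ≡ y
parentOrMax-< {y = y} {m} lt rewrite <⇒<F {i = y} {j = m} lt = refl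

parentOrMax-≥ : ∀ {N} {y m : Fin N} → toℕ m ≤ toℕ y → parentOrMax (just y) m ≡ m
parentOrMax-≥ {y = y} {m} le rewrite ≢true⇒≡false {y <F m} (λ e → NP.<⇒≱ (<F⇒< {i = y} {j = m} e) le) = refl

module TreeToPfd (n : ℕ) (p : PMap (suc n)) where
  N = suc n

  onSpine? : Fin N → Bool
  onSpine? x = isNotVertex1 x ∧ reaches? p zero x

  inSegment? : Fin N → Fin N → Bool
  inSegment? x z = isNotVertex1 z ∧ reaches? p zero z ∧ reaches? p z x

  segMax : Fin N → Fin N
  segMax x = fromMaybe x (greatest N (inSegment? x))

  spineSucc : Fin N → Fin N
  spineSucc x = parentOrMax (p x) (segMax x)

  -- On the spine, x keeps its parent while that is below the running maximum segMax x;
  -- otherwise x points back to the running maximum, which closes the current cycle.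
  Φ₀ : PMap N
  Φ₀ x = if onSpine? x then just (spineSucc x) else (if eqFin x zero then nothing else p x)

  Φ : PMap n
  Φ = unshift Φ₀

module TreeToPfdProperties (n : ℕ) (p : PMap (suc n)) (hT : isRootedTree p ≡ true) where
  open TreeToPfd n p
  open RootedTree n p hT public hiding (N)

  OnSpine : Fin N → Set
  OnSpine x = x ≢ zero × Reach p zero x

  InSegment : Fin N → Fin N → Set
  InSegment x z = z ≢ zero × Reach p zero z × Reach p z x

  onSpine?⇒OnSpine : ∀ {x} → onSpine? x ≡ true → OnSpine x
  onSpine?⇒OnSpine {x} e = let (a , b) = ∧≡true⁻ {isNotVertex1 x} e in isNotVertex1⇒≢ a , reaches?⇒Reach p b

  OnSpine⇒onSpine? : ∀ {x} → OnSpine x → onSpine? x ≡ true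
  OnSpine⇒onSpine? (a , b) = ∧≡true⁺ (≢⇒isNotVertex1 a) (Reach⇒reaches? p b)

  ¬OnSpine⇒onSpine?≡false : ∀ {x} → ¬ OnSpine x → onSpine? x ≡ false
  ¬OnSpine⇒onSpine?≡false h = ≢true⇒≡false (λ e → h (onSpine?⇒OnSpine e))

  inSegment?⇒InSegment : ∀ {x z} → inSegment? x z ≡ true → InSegment x z
  inSegment?⇒InSegment {x} {z} e = let (a , b) = ∧≡true⁻ {isNotVertex1 z} e ; (c , d) = ∧≡true⁻ {reaches? p zero z} b in isNotVertex1⇒≢ a , reaches?⇒Reach p c , reaches?⇒Reach p d

  InSegment⇒inSegment? : ∀ {x z} → InSegment x z → inSegment? x z ≡ true
  InSegment⇒inSegment? (a , b , c) = ∧≡true⁺ (≢⇒isNotVertex1 a) (∧≡true⁺ (Reach⇒reaches? p b) (Reach⇒reaches? p c))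

  segMax-spec : ∀ {x} → OnSpine x → InSegment x (segMax x) × (∀ z → InSegment x z → toℕ z ≤ toℕ (segMax x))
  segMax-spec {x} (a , b) with greatest N (inSegment? x) in eq
  ... | just m = let (u , v) = greatest-just N (inSegment? x) m eq in inSegment?⇒InSegment u , λ z s → v z (InSegment⇒inSegment? s)
  ... | nothing = ⊥-elim (true≢false (trans (sym (InSegment⇒inSegment? (a , b , reach-refl p x))) (greatest-nothing N (inSegment? x) eq x)))

  segMax-char : ∀ {x} m → OnSpine x → InSegment x m → (∀ z → InSegment x z → toℕ z ≤ toℕ m) → segMax x ≡ m
  segMax-char {x} m px sm up = toℕ-injective (NP.≤-antisym (up (segMax x) (proj₁ (segMax-spec px))) (proj₂ (segMax-spec px) m sm))

  ≤segMax : ∀ {x} → OnSpine x → toℕ x ≤ toℕ (segMax x)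
  ≤segMax (a , b) = proj₂ (segMax-spec (a , b)) _ (a , b , reach-refl p _)

  segMax-onSpine : ∀ {x} → OnSpine x → OnSpine (segMax x)
  segMax-onSpine px = let (a , b , c) = proj₁ (segMax-spec px) in a , b

  segMax-reaches : ∀ {x} → OnSpine x → Reach p (segMax x) x
  segMax-reaches px = proj₂ (proj₂ (proj₁ (segMax-spec px)))

  parent-onSpine : ∀ {x y} → OnSpine x → p x ≡ just y → OnSpine y
  parent-onSpine {x} {y} (a , b) e = (λ { refl → acyclic e b }) , reach-trans p b (reach-edge p e)

  segment-parent : ∀ {x y z} → Reach p zero x → p x ≡ just y → InSegment y z → InSegment x z ⊎ z ≡ y
  segment-parent {x} {y} {z} 0↝x e (a , b , c) with reach-comparable p b 0↝x
  ... | inj₁ rzx = inj₁ (a , b , rzx)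
  ... | inj₂ rxz with reach-uncons p rxz
  ... | inj₁ refl = inj₁ (a , b , reach-refl p _)
  ... | inj₂ (w , e' , rwz) with trans (sym e) e'
  ... | refl = inj₂ (reach-antisym c rwz)

  segMax-mono : ∀ {x y} → OnSpine x → OnSpine y → Reach p x y → toℕ (segMax x) ≤ toℕ (segMax y)
  segMax-mono px py r = let (a , b , c) = proj₁ (segMax-spec px) in proj₂ (segMax-spec py) _ (a , b , reach-trans p c r)

  segMax-idem : ∀ {x} → OnSpine x → segMax (segMax x) ≡ segMax x
  segMax-idem {x} px = segMax-char (segMax x) (segMax-onSpine px) (proj₁ (segMax-onSpine px) , proj₂ (segMax-onSpine px) , reach-refl p _)
                 (λ z (a , b , c) → proj₂ (segMax-spec px) z (a , b , reach-trans p c (segMax-reaches px)))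

  segMax-parent-< : ∀ {x y} → OnSpine x → p x ≡ just y → toℕ y < toℕ (segMax x) → segMax y ≡ segMax x
  segMax-parent-< {x} {y} px e lt = segMax-char (segMax x) py (a , b , reach-trans p c (reach-edge p e)) up
    where
    py = parent-onSpine px e
    s = proj₁ (segMax-spec px)
    a = proj₁ s
    b = proj₁ (proj₂ s)
    c = proj₂ (proj₂ s)
    up : ∀ z → InSegment y z → toℕ z ≤ toℕ (segMax x)
    up z sz with segment-parent (proj₂ px) e sz
    ... | inj₁ sx = proj₂ (segMax-spec px) z sx
    ... | inj₂ refl = NP.<⇒≤ lt

  spineSucc-cases : ∀ {x} → OnSpine x →
    (∃[ y ] (p x ≡ just y × toℕ y < toℕ (segMax x) × spineSucc x ≡ y)) ⊎
    (spineSucc x ≡ segMax x × (p x ≡ nothing ⊎ ∃[ y ] (p x ≡ just y × toℕ (segMax x) ≤ toℕ y)))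
  spineSucc-cases {x} px with p x in e
  ... | nothing = inj₂ (refl , inj₁ refl)
  ... | just y with y <F segMax x in lt
  ... | true = inj₁ (y , refl , <F⇒< lt , refl)
  ... | false = inj₂ (refl , inj₂ (y , refl , <F≡false⇒≥ lt))

  spineSucc-onSpine : ∀ {x} → OnSpine x → OnSpine (spineSucc x) × segMax (spineSucc x) ≡ segMax x
  spineSucc-onSpine {x} px with spineSucc-cases px
  ... | inj₁ (y , e , lt , se) rewrite se = parent-onSpine px e , segMax-parent-< px e lt
  ... | inj₂ (se , _) rewrite se = segMax-onSpine px , segMax-idem px

  Φ₀-onSpine : ∀ {x} → OnSpine x → Φ₀ x ≡ just (spineSucc x)
  Φ₀-onSpine px rewrite OnSpine⇒onSpine? px = refl

  Φ₀-offSpine : ∀ {x} → ¬ OnSpine x → x ≢ zero → Φ₀ x ≡ p x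
  Φ₀-offSpine {x} np nz0 rewrite ¬OnSpine⇒onSpine?≡false np | ≢⇒eqFin≡false nz0 = refl

  Φ₀-vertex1 : Φ₀ zero ≡ nothing
  Φ₀-vertex1 = refl

  Φ₀-closed : ∀ {x z} → OnSpine x → Reach Φ₀ x z → OnSpine z × segMax z ≡ segMax x
  Φ₀-closed {x} px r = reach-invariant Φ₀ (λ u → OnSpine u × segMax u ≡ segMax x) step (px , refl) r
    where
    step : ∀ {u v} → OnSpine u × segMax u ≡ segMax x → Φ₀ u ≡ just v → OnSpine v × segMax v ≡ segMax x
    step (pu , mu) e with trans (sym (Φ₀-onSpine pu)) e
    ... | refl = proj₁ (spineSucc-onSpine pu) , trans (proj₂ (spineSucc-onSpine pu)) mu

  Φ₀-reaches-segMax : ∀ {z} → OnSpine z → Reach Φ₀ z (segMax z)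
  Φ₀-reaches-segMax {z} pz = go (suc n) (iter-escapes z) pz
    where
    go : ∀ t {z} → iter p t z ≡ nothing → OnSpine z → Reach Φ₀ z (segMax z)
    go zero () pz
    go (suc t) {z} e pz with spineSucc-cases pz
    ... | inj₂ (se , _) = reach-edge Φ₀ (trans (Φ₀-onSpine pz) (cong just se))
    ... | inj₁ (y , ey , lt , se) =
      let py = parent-onSpine pz ey
          my = segMax-parent-< pz ey lt
      in reach-step Φ₀ (trans (Φ₀-onSpine pz) (cong just se))
           (subst (Reach Φ₀ y) my (go t (trans (sym (iter-suc-just p t z y ey)) e) py))

  -- On the way up from segMax z to z every parent lies below the running maximum, so Φ₀ follows p.
  segMax-Φ₀-reaches : ∀ {z} → OnSpine z → Reach Φ₀ (segMax z) z
  segMax-Φ₀-reaches {z} pz = reach-transfer-along p Φ₀ agree (segMax-reaches pz)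
    where
    pm = segMax-onSpine pz
    agree : ∀ u → Reach p (segMax z) u → Reach p u z → u ≢ z → p u ≡ Φ₀ u
    agree u r1 r2 ne with reach-uncons p r2
    ... | inj₁ eq = ⊥-elim (ne eq)
    ... | inj₂ (y , ey , ryz) = trans ey (sym (trans (Φ₀-onSpine pu) (cong just sy)))
      where
      u0 : u ≢ zero
      u0 refl = proj₁ pm (reach-antisym r1 (proj₂ pm))
      pu : OnSpine u
      pu = u0 , reach-trans p (proj₂ pm) r1
      mu : segMax u ≡ segMax z
      mu = toℕ-injective (NP.≤-antisym (segMax-mono pu pz r2) (proj₂ (segMax-spec pu) (segMax z) (proj₁ pm , proj₂ pm , r1)))
      py = parent-onSpine pu ey
      y≤ : toℕ y ≤ toℕ (segMax z)
      y≤ = proj₂ (segMax-spec pz) y (proj₁ py , proj₂ py , ryz)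
      y≢ : y ≢ segMax z
      y≢ refl = acyclic ey r1
      y< : toℕ y < toℕ (segMax u)
      y< = subst (λ t → toℕ y < toℕ t) (sym mu) (NP.≤∧≢⇒< y≤ (λ q → y≢ (toℕ-injective q)))
      sy : spineSucc u ≡ y
      sy = trans (cong (λ m → parentOrMax m (segMax u)) ey) (parentOrMax-< y<)

  Φ₀-cyclic : ∀ {x y} → OnSpine x → Φ₀ x ≡ just y → Reach Φ₀ y x
  Φ₀-cyclic {x} px e with trans (sym (Φ₀-onSpine px)) e
  ... | refl = let (ps , ms) = spineSucc-onSpine px in reach-trans Φ₀ (subst (Reach Φ₀ (spineSucc x)) ms (Φ₀-reaches-segMax ps)) (segMax-Φ₀-reaches px)

  offSpine-Reach-p⇒Φ₀ : ∀ {x d} → ¬ OnSpine x → x ≢ zero → Reach p d x → Reach Φ₀ d x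
  offSpine-Reach-p⇒Φ₀ {x} np x0 r = reach-transfer p Φ₀ agree r
    where
    agree : ∀ u → Reach p u x → u ≢ x → p u ≡ Φ₀ u
    agree u ru ne = sym (Φ₀-offSpine (λ pu → np (x0 , reach-trans p (proj₂ pu) ru)) (λ { refl → np (x0 , ru) }))

  onSpine-dec : ∀ u → OnSpine u ⊎ ¬ OnSpine u
  onSpine-dec u with onSpine? u in eq
  ... | true = inj₁ (onSpine?⇒OnSpine eq)
  ... | false = inj₂ (λ pu → true≢false (trans (sym (OnSpine⇒onSpine? pu)) eq))

  offSpine-Reach-Φ₀⇒p : ∀ {x d} → ¬ OnSpine x → x ≢ zero → Reach Φ₀ d x → Reach p d x
  offSpine-Reach-Φ₀⇒p {x} np x0 r = reach-transfer Φ₀ p agree r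
    where
    agree : ∀ u → Reach Φ₀ u x → u ≢ x → Φ₀ u ≡ p u
    agree u ru ne with u FP.≟ zero
    ... | yes refl = ⊥-elim (x0 (sym (reach-from-sink Φ₀ Φ₀-vertex1 ru)))
    ... | no u0 with onSpine-dec u
    ... | inj₁ pu = ⊥-elim (np (proj₁ (Φ₀-closed pu ru)))
    ... | inj₂ npu = Φ₀-offSpine npu u0

  root-onSpine : ∀ {x} → p x ≡ nothing → x ≢ zero → OnSpine x
  root-onSpine {x} e x0 with reach-root zero
  ... | r , er , rr with root-unique e er
  ... | refl = x0 , rr

  offSpine-parent : ∀ {x} → ¬ OnSpine x → x ≢ zero → ∃[ y ] (p x ≡ just y)
  offSpine-parent {x} np x0 with p x in e
  ... | just y = y , refl
  ... | nothing = ⊥-elim (np (root-onSpine e x0))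

module TreeToPfdStatistics (n : ℕ) (p : PMap (suc n)) (hT : isRootedTree p ≡ true) where
  open TreeToPfd n p
  open TreeToPfdProperties n p hT

  Reach-Φ₀⇒Φ : ∀ {a b} → Reach Φ₀ (suc a) (suc b) → Reach Φ a b
  Reach-Φ₀⇒Φ = reach-unshift⁺ Φ₀ Φ₀-vertex1

  Reach-Φ⇒Φ₀ : ∀ {a b} → Reach Φ a b → Reach Φ₀ (suc a) (suc b)
  Reach-Φ⇒Φ₀ = reach-unshift⁻ Φ₀

  onSpine-Φ : ∀ {j} → OnSpine (suc j) → ∃[ i ] (Φ j ≡ just i × Reach Φ i j)
  onSpine-Φ {j} px with ≢zero⇒suc (spineSucc (suc j)) (proj₁ (proj₁ (spineSucc-onSpine px)))
  ... | i , si = i , cong unshiftTarget (trans (Φ₀-onSpine px) (cong just si)) ,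
                 Reach-Φ₀⇒Φ (subst (λ t → Reach Φ₀ t (suc j)) si (Φ₀-cyclic px (Φ₀-onSpine px)))

  offSpine-Φ : ∀ {j} → ¬ OnSpine (suc j) →
    (p (suc j) ≡ just zero × Φ j ≡ nothing) ⊎ ∃[ i ] (p (suc j) ≡ just (suc i) × Φ j ≡ just i)
  offSpine-Φ np with offSpine-parent np (λ ())
  ... | zero  , e = inj₁ (e , cong unshiftTarget (trans (Φ₀-offSpine np (λ ())) e))
  ... | suc i , e = inj₂ (i , e , cong unshiftTarget (trans (Φ₀-offSpine np (λ ())) e))

  lowDescendant? : Fin N → Fin N → Fin N → Bool
  lowDescendant? x y d = isDescendant p d x ∧ (d <F y)

  lowPredecessor? : Fin n → Fin n → Fin n → Bool
  lowPredecessor? j i k = isPredecessor Φ k j ∧ (k ≤F i)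

  improper-above-vertex1 : ∀ {x y} → Reach p zero x → p x ≡ just y → improperAt p x ≡ true
  improper-above-vertex1 {x} {y} r e = trans (improperAt-child p e)
    (anyFin⁺ N (lowDescendant? x y) zero (∧≡true⁺ (Reach⇒reaches? p r) (<⇒<F {i = zero} {j = y} (≢zero⇒0< y≢0))))
    where
    y≢0 : y ≢ zero
    y≢0 refl = acyclic e r

  not-child-above-vertex1 : ∀ {x} → Reach p zero x → isJustAt zero (p x) ≡ false
  not-child-above-vertex1 {x} r with Maybe-cases (p x)
  ... | inj₁ e       = cong (isJustAt zero) e
  ... | inj₂ (y , e) = trans (cong (isJustAt zero) e) (≢⇒eqFin≡false {i = zero} {j = y} λ { refl → acyclic e r })

  onSpine-pfdImproper : ∀ {j} → OnSpine (suc j) → pfdImproperAt Φ j ≡ true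
  onSpine-pfdImproper {j} px with onSpine-Φ px
  ... | i , Φj , r = trans (pfdImproperAt-edge Φ Φj)
    (anyFin⁺ n (lowPredecessor? j i) i (∧≡true⁺ (Reach⇒reaches? Φ r) (≤⇒≤F {i = i} {j = i} NP.≤-refl)))

  child-of-vertex1≡sink : ∀ j → isJustAt zero (p (suc j)) ≡ isNothing (Φ j)
  child-of-vertex1≡sink j with onSpine-dec (suc j)
  ... | inj₁ px = trans (not-child-above-vertex1 (proj₂ px)) (cong isNothing (sym (proj₁ (proj₂ (onSpine-Φ px)))))
  ... | inj₂ np with offSpine-Φ np
  ...   | inj₁ (e , Φj)     = trans (cong (isJustAt zero) e) (cong isNothing (sym Φj))
  ...   | inj₂ (i , e , Φj) = trans (cong (isJustAt zero) e) (cong isNothing (sym Φj))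

  not-proper-above-vertex1 : ∀ {x} → Reach p zero x → properAt p x ≡ false
  not-proper-above-vertex1 {x} r with Maybe-cases (p x)
  ... | inj₁ e       = properAt-root p e
  ... | inj₂ (y , e) = trans (properAt-child p e) (cong not (improper-above-vertex1 r e))

  offSpine-lowDescendant≡lowPredecessor : ∀ {j i} → ¬ OnSpine (suc j) → p (suc j) ≡ just (suc i) →
    anyFin N (lowDescendant? (suc j) (suc i)) ≡ anyFin n (lowPredecessor? j i)
  offSpine-lowDescendant≡lowPredecessor {j} {i} np e = Bool-≡-⇔ descendant⇒predecessor predecessor⇒descendant
    where
    descendant⇒predecessor : anyFin N (lowDescendant? (suc j) (suc i)) ≡ true → anyFin n (lowPredecessor? j i) ≡ true
    descendant⇒predecessor h with anyFin⁻ N (lowDescendant? (suc j) (suc i)) h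
    ... | zero  , q = ⊥-elim (np ((λ ()) , reaches?⇒Reach p (proj₁ (∧≡true⁻ q))))
    ... | suc k , q = let (q₁ , q₂) = ∧≡true⁻ q in
      anyFin⁺ n (lowPredecessor? j i) k
        (∧≡true⁺ (Reach⇒reaches? Φ (Reach-Φ₀⇒Φ (offSpine-Reach-p⇒Φ₀ np (λ ()) (reaches?⇒Reach p q₁))))
                 (≤⇒≤F {i = k} {j = i} (NP.<⇒≤ (NP.≤-pred (<F⇒< {i = suc k} {j = suc i} q₂)))))
    predecessor⇒descendant : anyFin n (lowPredecessor? j i) ≡ true → anyFin N (lowDescendant? (suc j) (suc i)) ≡ true
    predecessor⇒descendant h with anyFin⁻ n (lowPredecessor? j i) h
    ... | k , q = anyFin⁺ N (lowDescendant? (suc j) (suc i)) (suc k)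
                    (∧≡true⁺ (Reach⇒reaches? p sk↝x) (<⇒<F {i = suc k} {j = suc i} (s≤s k<i)))
      where
      sk↝x : Reach p (suc k) (suc j)
      sk↝x = offSpine-Reach-Φ₀⇒p np (λ ()) (Reach-Φ⇒Φ₀ (reaches?⇒Reach Φ (proj₁ (∧≡true⁻ q))))
      k<i : toℕ k < toℕ i
      k<i = NP.≤∧≢⇒< (≤F⇒≤ {i = k} {j = i} (proj₂ (∧≡true⁻ {isPredecessor Φ k j} q))) λ k≡i → acyclic e (subst (λ t → Reach p (suc t) (suc j)) (toℕ-injective k≡i) sk↝x)

  improper≡pfdImproper : ∀ j → p (suc j) ≢ nothing → improperAt p (suc j) ≡ pfdImproperAt Φ j
  improper≡pfdImproper j nn with onSpine-dec (suc j)
  ... | inj₁ px with Maybe-cases (p (suc j))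
  ...   | inj₁ e       = ⊥-elim (nn e)
  ...   | inj₂ (y , e) = trans (improper-above-vertex1 (proj₂ px) e) (sym (onSpine-pfdImproper px))
  improper≡pfdImproper j nn | inj₂ np with offSpine-Φ np
  ... | inj₁ (e , Φj)     = trans (improperAt-child p e)
                              (trans (anyFin-none N _ (λ d → ∧-zeroʳ _)) (sym (pfdImproperAt-sink Φ Φj)))
  ... | inj₂ (i , e , Φj) = trans (improperAt-child p e)
                              (trans (offSpine-lowDescendant≡lowPredecessor np e) (sym (pfdImproperAt-edge Φ Φj)))

  offSpine-proper : ∀ {j y} → ¬ OnSpine (suc j) → p (suc j) ≡ just y → properAt p (suc j) ≡ not (pfdImproperAt Φ j)
  offSpine-proper {j} np e = trans (properAt-child p e) (cong not (improper≡pfdImproper j (λ q → just≢nothing (trans (sym e) q))))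

  proper≡pfdProper∨child : ∀ j → properAt p (suc j) ≡ pfdProperAt Φ j ∨ isJustAt zero (p (suc j))
  proper≡pfdProper∨child j with onSpine-dec (suc j)
  ... | inj₁ px = trans (not-proper-above-vertex1 (proj₂ px)) (sym (cong₂ _∨_
        (trans (pfdProperAt-edge Φ (proj₁ (proj₂ (onSpine-Φ px)))) (cong not (onSpine-pfdImproper px)))
        (not-child-above-vertex1 (proj₂ px))))
  ... | inj₂ np with offSpine-Φ np
  ...   | inj₁ (e , Φj)     = trans (offSpine-proper np e) (trans (cong not (pfdImproperAt-sink Φ Φj))
                                (sym (cong₂ _∨_ (pfdProperAt-sink Φ Φj) (cong (isJustAt zero) e))))
  ...   | inj₂ (i , e , Φj) = trans (offSpine-proper np e) (trans (sym (pfdProperAt-edge Φ Φj))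
                                (sym (trans (cong (pfdProperAt Φ j ∨_) (cong (isJustAt zero) e)) (∨-identityʳ _))))

  pfdProper-child-disjoint : ∀ j → (pfdProperAt Φ j ∧ isJustAt zero (p (suc j))) ≡ false
  pfdProper-child-disjoint j with isJustAt zero (p (suc j)) in e
  ... | false = ∧-zeroʳ _
  ... | true  = cong (_∧ true) (pfdProperAt-sink Φ (isNothing⇒≡nothing (trans (sym (child-of-vertex1≡sink j)) e)))

  childrenOf1≡outDeg0 : childrenOf1 p ≡ outDeg0 Φ
  childrenOf1≡outDeg0 = begin
    childrenOf1 p
      ≡⟨ countFin-suc n (λ j → isJustAt zero (p j)) ⟩
    indicator (isJustAt zero (p zero)) + countFin n (λ j → isJustAt zero (p (suc j)))
      ≡⟨ cong₂ _+_ (cong indicator (not-child-above-vertex1 (reach-refl p zero))) (countFin-cong n child-of-vertex1≡sink) ⟩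
    outDeg0 Φ ∎
    where open ≡-Reasoning

  treeImprope≡pfdImprope : treeImprope p ≡ pfdImprope Φ
  treeImprope≡pfdImprope = trans (countFin-suc n (improperAt p)) vertex1-and-rest
    where
    vertex1-and-rest : indicator (improperAt p zero) + countFin n (improperAt p ∘ suc) ≡ pfdImprope Φ
    vertex1-and-rest with Maybe-cases (p zero)
    ... | inj₁ e = cong₂ _+_ (cong indicator (improperAt-root p e))
                     (countFin-cong n (λ j → improper≡pfdImproper j (λ q → case root-unique q e of λ ())))
    ... | inj₂ (y , e) with reach-root zero
    ...   | zero  , er , _ = ⊥-elim (just≢nothing (trans (sym e) er))
    ...   | suc r , er , _ =
      -- the improper edge out of vertex 1 disappears, and the root gains one
      trans (cong (λ b → indicator b + countFin n (improperAt p ∘ suc)) (improper-above-vertex1 (reach-refl p zero) e))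
        (sym (countFin-flip n (improperAt p ∘ suc) (pfdImproperAt Φ) r
                (λ j j≢r → improper≡pfdImproper j (λ q → j≢r (FP.suc-injective (root-unique q er))))
                (improperAt-root p er) (onSpine-pfdImproper (root-onSpine er (λ ())))))

  treePrope≡pfdPrope+outDeg0 : treePrope p ≡ pfdPrope Φ + outDeg0 Φ
  treePrope≡pfdPrope+outDeg0 = begin
    treePrope p
      ≡⟨ countFin-suc n (properAt p) ⟩
    indicator (properAt p zero) + countFin n (properAt p ∘ suc)
      ≡⟨ cong₂ _+_ (cong indicator (not-proper-above-vertex1 (reach-refl p zero))) (countFin-cong n proper≡pfdProper∨child) ⟩
    countFin n (λ j → pfdProperAt Φ j ∨ isJustAt zero (p (suc j)))
      ≡⟨ countFin-∨ n (pfdProperAt Φ) _ pfdProper-child-disjoint ⟩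
    pfdPrope Φ + countFin n (λ j → isJustAt zero (p (suc j)))
      ≡⟨ cong (pfdPrope Φ +_) (countFin-cong n child-of-vertex1≡sink) ⟩
    pfdPrope Φ + outDeg0 Φ ∎
    where open ≡-Reasoning

  counting-condition : ∀ k a b →
    (isRootedTree p ∧ (childrenOf1 p ≡ᵇ k) ∧ (treeImprope p ≡ᵇ a) ∧ (treePrope p ≡ᵇ b + k))
      ≡ ((outDeg0 Φ ≡ᵇ k) ∧ (pfdImprope Φ ≡ᵇ a) ∧ (pfdPrope Φ ≡ᵇ b))
  counting-condition k a b rewrite hT | childrenOf1≡outDeg0 | treeImprope≡pfdImprope | treePrope≡pfdPrope+outDeg0 =
    ≡ᵇ∧≡ᵇ∧-+-cancelʳ (outDeg0 Φ) k (pfdImprope Φ) a (pfdPrope Φ) b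

-- From partial functional digraphs back to rooted trees

module PfdToTree (n : ℕ) (f : PMap n) where
  N = suc n

  F : PMap N
  F = shift f

  onCycleVia? : Maybe (Fin N) → Fin N → Bool
  onCycleVia? (just y) x = reaches? F y x
  onCycleVia? nothing  x = false

  onCycle? : Fin N → Bool
  onCycle? x = onCycleVia? (F x) x

  cycleMax : Fin N → Fin N
  cycleMax x = fromMaybe x (greatest N (reaches? F x))

  isCycleMax? : Fin N → Bool
  isCycleMax? c = onCycle? c ∧ eqFin (cycleMax c) c

  nextCycleMax : Fin N → Maybe (Fin N)
  nextCycleMax v = least N (λ c → isCycleMax? c ∧ (v <F c))

  cutsCycle? : Fin N → Bool
  cutsCycle? x = onCycle? x ∧ isJustAt (cycleMax x) (F x)

  -- Each cycle is cut just before its maximum, and the cut ends are chained by increasing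
  -- maximum starting from vertex 1; the vertex cut from the largest cycle becomes the root.
  Ψ : PMap N
  Ψ x = if eqFin x zero then nextCycleMax zero else (if cutsCycle? x then nextCycleMax (cycleMax x) else F x)

module PfdToTreeProperties (n : ℕ) (f : PMap n) where
  open PfdToTree n f

  F-vertex1 : F zero ≡ nothing
  F-vertex1 = refl

  F-suc : ∀ j → ∃[ y ] (F (suc j) ≡ just y)
  F-suc j with f j
  ... | nothing = zero , refl
  ... | just i = suc i , refl

  OnCycle : Fin N → Set
  OnCycle x = ∃[ y ] (F x ≡ just y × Reach F y x)

  onCycle?-edge : ∀ {x y} → F x ≡ just y → onCycle? x ≡ reaches? F y x
  onCycle?-edge {x} e = cong (λ m → onCycleVia? m x) e

  onCycle?⇒OnCycle : ∀ {x} → onCycle? x ≡ true → OnCycle x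
  onCycle?⇒OnCycle {zero} ()
  onCycle?⇒OnCycle {suc j} e = let (y , ey) = F-suc j in y , ey , reaches?⇒Reach F (trans (sym (onCycle?-edge ey)) e)

  OnCycle⇒onCycle? : ∀ {x} → OnCycle x → onCycle? x ≡ true
  OnCycle⇒onCycle? (y , ey , r) = trans (onCycle?-edge ey) (Reach⇒reaches? F r)

  OnCycle⇒≢vertex1 : ∀ {x} → OnCycle x → x ≢ zero
  OnCycle⇒≢vertex1 (y , () , r) refl

  cycle-period : ∀ {x} → OnCycle x → ∃[ s ] (iter F (suc s) x ≡ just x)
  cycle-period {x} (y , ey , (s , e)) = s , trans (iter-suc-just F s x y ey) e

  cycle-reach-back : ∀ {x z} → OnCycle x → Reach F x z → Reach F z x
  cycle-reach-back {x} {z} cx (t , e) =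
    let (s , ep) = cycle-period cx
        L = suc s
        le : t ≤ t * L
        le = NP.m≤m*n t L
        e1 : iter F (t * L) x ≡ just x
        e1 = iter-periodic F L ep t
    in (t * L ∸ t) , trans (sym (iter-+ F t (t * L ∸ t) e)) (trans (cong (λ u → iter F u x) (NP.m+[n∸m]≡n le)) e1)

  cycle-closed : ∀ {x z} → OnCycle x → Reach F x z → OnCycle z × Reach F z x
  cycle-closed {x} {z} cx r with cycle-reach-back cx r
  ... | rzx with reach-uncons F rzx
  ... | inj₁ refl = cx , rzx
  ... | inj₂ (w , e , rwx) = (w , e , reach-trans F rwx r) , rzx

  cycleMax-spec : ∀ x → Reach F x (cycleMax x) × (∀ z → Reach F x z → toℕ z ≤ toℕ (cycleMax x))
  cycleMax-spec x with greatest N (reaches? F x) in eq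
  ... | just m = let (a , b) = greatest-just N (reaches? F x) m eq in reaches?⇒Reach F a , λ z r → b z (Reach⇒reaches? F r)
  ... | nothing = ⊥-elim (true≢false (trans (sym (Reach⇒reaches? F (reach-refl F x))) (greatest-nothing N (reaches? F x) eq x)))

  cycleMax-char : ∀ {x} m → Reach F x m → (∀ z → Reach F x z → toℕ z ≤ toℕ m) → cycleMax x ≡ m
  cycleMax-char {x} m rm up = toℕ-injective (NP.≤-antisym (up (cycleMax x) (proj₁ (cycleMax-spec x))) (proj₂ (cycleMax-spec x) m rm))

  ≤cycleMax : ∀ x → toℕ x ≤ toℕ (cycleMax x)
  ≤cycleMax x = proj₂ (cycleMax-spec x) x (reach-refl F x)

  cycleMax-vertex1 : cycleMax zero ≡ zero
  cycleMax-vertex1 = cycleMax-char zero (reach-refl F zero) (λ z r → subst (λ t → toℕ t ≤ 0) (reach-from-sink F F-vertex1 r) z≤n)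

  cycleMax-reach : ∀ {x z} → OnCycle x → Reach F x z → cycleMax z ≡ cycleMax x
  cycleMax-reach {x} {z} cx r =
    let rzx = cycle-reach-back cx r in
    cycleMax-char (cycleMax x) (reach-trans F rzx (proj₁ (cycleMax-spec x)))
      (λ w rw → proj₂ (cycleMax-spec x) w (reach-trans F r rw))

  IsCycleMax : Fin N → Set
  IsCycleMax c = OnCycle c × cycleMax c ≡ c

  cycleMax-IsCycleMax : ∀ {x} → OnCycle x → IsCycleMax (cycleMax x)
  cycleMax-IsCycleMax {x} cx = let r = proj₁ (cycleMax-spec x) in proj₁ (cycle-closed cx r) , cycleMax-reach cx r

  isCycleMax?⇒IsCycleMax : ∀ {c} → isCycleMax? c ≡ true → IsCycleMax c
  isCycleMax?⇒IsCycleMax {c} e = let (a , b) = ∧≡true⁻ {onCycle? c} e in onCycle?⇒OnCycle a , eqFin⇒≡ b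

  IsCycleMax⇒isCycleMax? : ∀ {c} → IsCycleMax c → isCycleMax? c ≡ true
  IsCycleMax⇒isCycleMax? {c} (a , b) = ∧≡true⁺ (OnCycle⇒onCycle? a) (trans (cong (λ t → eqFin t c) b) (eqFin-refl c))

  common-successor-reach : ∀ {a b w} → F a ≡ just w → F b ≡ just w → Reach F w a → Reach F a b → a ≡ b
  common-successor-reach fa fb rwa (zero , refl) = refl
  common-successor-reach {a} {b} {w} fa fb (s , ea) (suc t , e) =
    let e1 : iter F t w ≡ just b
        e1 = trans (sym (iter-suc-just F t a w fa)) e
        eT : iter F (suc t) w ≡ just w
        eT = iter-snoc F t e1 fb
        x1 : iter F (suc t + s) w ≡ just a
        x1 = trans (iter-+ F (suc t) s {x = w} eT) ea
        x2 : iter F (s + suc t) w ≡ just b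
        x2 = trans (iter-+ F s (suc t) {x = w} ea) e
    in just-injective (trans (sym x1) (trans (cong (λ u → iter F u w) (NP.+-comm (suc t) s)) x2))

  cycle-predecessor-unique : ∀ {x x'} → OnCycle x → OnCycle x' → F x ≡ F x' → x ≡ x'
  cycle-predecessor-unique {x} {x'} (w , ew , rwx) (w' , ew' , rwx') eqF with trans (sym ew) (trans eqF ew')
  ... | refl with reach-comparable F rwx rwx'
  ... | inj₁ r = common-successor-reach ew ew' rwx r
  ... | inj₂ r = sym (common-successor-reach ew' ew rwx' r)

  cycle-predecessor : ∀ {c} → OnCycle c → ∃[ e ] (F e ≡ just c × Reach F c e × OnCycle e)
  cycle-predecessor {c} cc with cycle-period cc
  ... | s , ep with iter-unsnoc F s ep
  ... | e , ee , fe = let r = (s , ee) in e , fe , r , proj₁ (cycle-closed cc r)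

  CutsCycle : Fin N → Set
  CutsCycle x = OnCycle x × F x ≡ just (cycleMax x)

  isJustAt⇒≡just : ∀ {c : Fin N} {m} → isJustAt c m ≡ true → m ≡ just c
  isJustAt⇒≡just {m = just y} e = cong just (sym (eqFin⇒≡ e))

  ≡just⇒isJustAt : ∀ {c : Fin N} {m} → m ≡ just c → isJustAt c m ≡ true
  ≡just⇒isJustAt {c} refl = eqFin-refl c

  cutsCycle?⇒CutsCycle : ∀ {x} → cutsCycle? x ≡ true → CutsCycle x
  cutsCycle?⇒CutsCycle {x} e = let (a , b) = ∧≡true⁻ {onCycle? x} e in onCycle?⇒OnCycle a , isJustAt⇒≡just b

  CutsCycle⇒cutsCycle? : ∀ {x} → CutsCycle x → cutsCycle? x ≡ true
  CutsCycle⇒cutsCycle? (a , b) = ∧≡true⁺ (OnCycle⇒onCycle? a) (≡just⇒isJustAt b)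

  ¬CutsCycle⇒cutsCycle?≡false : ∀ {x} → ¬ CutsCycle x → cutsCycle? x ≡ false
  ¬CutsCycle⇒cutsCycle?≡false h = ≢true⇒≡false (λ e → h (cutsCycle?⇒CutsCycle e))

  isCycleMaxAbove? : Fin N → Fin N → Bool
  isCycleMaxAbove? v c = isCycleMax? c ∧ (v <F c)

  nextCycleMax-just : ∀ {v c} → nextCycleMax v ≡ just c → IsCycleMax c × toℕ v < toℕ c × (∀ d → IsCycleMax d → toℕ v < toℕ d → toℕ c ≤ toℕ d)
  nextCycleMax-just {v} {c} e =
    let (a , b) = least-just N (isCycleMaxAbove? v) c e
        (a1 , a2) = ∧≡true⁻ {isCycleMax? c} a
    in isCycleMax?⇒IsCycleMax a1 , <F⇒< {i = v} {j = c} a2 , λ d cd lt → b d (∧≡true⁺ (IsCycleMax⇒isCycleMax? cd) (<⇒<F {i = v} {j = d} lt))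

  nextCycleMax-nothing : ∀ {v} → nextCycleMax v ≡ nothing → ∀ d → IsCycleMax d → ¬ toℕ v < toℕ d
  nextCycleMax-nothing {v} e d cd lt = true≢false (trans (sym (∧≡true⁺ (IsCycleMax⇒isCycleMax? cd) (<⇒<F {i = v} {j = d} lt))) (least-nothing N (isCycleMaxAbove? v) e d))

  nextCycleMax-char : ∀ {v} c → IsCycleMax c → toℕ v < toℕ c → (∀ d → IsCycleMax d → toℕ v < toℕ d → toℕ c ≤ toℕ d) → nextCycleMax v ≡ just c
  nextCycleMax-char {v} c cc lt up = least-char N (isCycleMaxAbove? v) c (∧≡true⁺ (IsCycleMax⇒isCycleMax? cc) (<⇒<F {i = v} {j = c} lt))
    (λ d e → let (a1 , a2) = ∧≡true⁻ {isCycleMax? d} e in up d (isCycleMax?⇒IsCycleMax a1) (<F⇒< {i = v} {j = d} a2))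

  nextCycleMax-none : ∀ {v} → (∀ d → IsCycleMax d → ¬ toℕ v < toℕ d) → nextCycleMax v ≡ nothing
  nextCycleMax-none {v} h = least-none N (isCycleMaxAbove? v) (λ d → ≢true⇒≡false (λ e → let (a1 , a2) = ∧≡true⁻ {isCycleMax? d} e in h d (isCycleMax?⇒IsCycleMax a1) (<F⇒< {i = v} {j = d} a2)))

  Ψ-cut : ∀ {x} → CutsCycle x → Ψ x ≡ nextCycleMax (cycleMax x)
  Ψ-cut {x} cut rewrite ≢⇒eqFin≡false (OnCycle⇒≢vertex1 (proj₁ cut)) | CutsCycle⇒cutsCycle? cut = refl

  cutVertex : ∀ {c} → IsCycleMax c → ∃[ e ] (Reach F c e × CutsCycle e × cycleMax e ≡ c)
  cutVertex (cc , c-max) =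
    let (e , Fe , c↝e , ce) = cycle-predecessor cc
        e-max = trans (cycleMax-reach cc c↝e) c-max
    in e , c↝e , (ce , trans Fe (cong just (sym e-max))) , e-max

  Ψ-uncut : ∀ {x} → x ≢ zero → ¬ CutsCycle x → Ψ x ≡ F x
  Ψ-uncut {x} x≢0 b rewrite ≢⇒eqFin≡false x≢0 | ¬CutsCycle⇒cutsCycle?≡false b = refl

  cutsCycle-dec : ∀ x → CutsCycle x ⊎ ¬ CutsCycle x
  cutsCycle-dec x with cutsCycle? x in eq
  ... | true = inj₁ (cutsCycle?⇒CutsCycle eq)
  ... | false = inj₂ (λ b → true≢false (trans (sym (CutsCycle⇒cutsCycle? b)) eq))

  period⇒OnCycle : ∀ {v} t → iter F (suc t) v ≡ just v → OnCycle v
  period⇒OnCycle {v} t e with F v in eq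
  ... | just y = y , refl , t , e
  ... | nothing = ⊥-elim (just≢nothing (sym e))

  InSpine : Fin N → Set
  InSpine x = x ≡ zero ⊎ OnCycle x

  Ψ-step-InSpine : ∀ {u v} → InSpine u → Ψ u ≡ just v →
    InSpine v × toℕ (cycleMax u) ≤ toℕ (cycleMax v) × ((u ≡ zero ⊎ CutsCycle u) → toℕ (cycleMax u) < toℕ (cycleMax v))
  Ψ-step-InSpine {u} {v} (inj₁ refl) e =
    let (cv , lt , _) = nextCycleMax-just e
        lt' : toℕ (cycleMax zero) < toℕ (cycleMax v)
        lt' = subst₂ (λ a b → toℕ a < toℕ b) (sym cycleMax-vertex1) (sym (proj₂ cv)) lt
    in inj₂ (proj₁ cv) , NP.<⇒≤ lt' , λ _ → lt'
  Ψ-step-InSpine {u} {v} (inj₂ cu) e with cutsCycle-dec u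
  ... | inj₁ cut =
    let (cv , lt , _) = nextCycleMax-just (trans (sym (Ψ-cut cut)) e)
        lt' : toℕ (cycleMax u) < toℕ (cycleMax v)
        lt' = subst (λ b → toℕ (cycleMax u) < toℕ b) (sym (proj₂ cv)) lt
    in inj₂ (proj₁ cv) , NP.<⇒≤ lt' , λ _ → lt'
  ... | inj₂ nb =
    let fe = trans (sym (Ψ-uncut (OnCycle⇒≢vertex1 cu) nb)) e
        r = reach-edge F fe
        ce = cycleMax-reach cu r
    in inj₂ (proj₁ (cycle-closed cu r)) , NP.≤-reflexive (cong toℕ (sym ce)) ,
       λ { (inj₁ refl) → ⊥-elim (OnCycle⇒≢vertex1 cu refl) ; (inj₂ b) → ⊥-elim (nb b) }

  Ψ-walk-cycleMax : ∀ i {u w} → InSpine u → iter Ψ i u ≡ just w →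
    InSpine w × toℕ (cycleMax u) ≤ toℕ (cycleMax w) ×
    (∀ j z → j < i → iter Ψ j u ≡ just z → (z ≡ zero ⊎ CutsCycle z) → toℕ (cycleMax u) < toℕ (cycleMax w))
  Ψ-walk-cycleMax zero su refl = su , NP.≤-refl , λ j z ()
  Ψ-walk-cycleMax (suc i) {u} {w} su e with Ψ u in eq
  ... | nothing = ⊥-elim (just≢nothing (sym e))
  ... | just u1 =
    let (s1 , le1 , st1) = Ψ-step-InSpine su eq
        (sw , le2 , st2) = Ψ-walk-cycleMax i s1 e
    in sw , NP.≤-trans le1 le2 ,
       λ { zero z _ refl q → NP.<-≤-trans (st1 q) le2
         ; (suc j) z (s≤s lt) ez q → NP.≤-<-trans le1 (st2 j z lt (trans (sym (iter-suc-just Ψ j u u1 eq)) ez) q) }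

  Ψ-walk-agrees-F : ∀ i {u w} → iter Ψ i u ≡ just w → (∀ j z → j < i → iter Ψ j u ≡ just z → Ψ z ≡ F z) → iter F i u ≡ just w
  Ψ-walk-agrees-F zero e h = e
  Ψ-walk-agrees-F (suc i) {u} {w} e h with Ψ u in eq
  ... | nothing = ⊥-elim (just≢nothing (sym e))
  ... | just u1 =
    let fu : F u ≡ just u1
        fu = trans (sym (h 0 u (s≤s z≤n) refl)) eq
    in trans (iter-suc-just F i u u1 fu)
         (Ψ-walk-agrees-F i e (λ j z lt ez → h (suc j) z (s≤s lt) (trans (iter-suc-just Ψ j u u1 eq) ez)))

  Ψ-walk-outside : ∀ i {v w} → iter Ψ i v ≡ just w → ¬ InSpine w → iter F i v ≡ just w
  Ψ-walk-outside zero e nw = e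
  Ψ-walk-outside (suc i) {v} {w} e nw =
    let (z , ez , Ψz) = iter-unsnoc Ψ i {x = v} e
        z∉ : ¬ InSpine z
        z∉ = λ sz → nw (proj₁ (Ψ-step-InSpine sz Ψz))
        z0 : z ≢ zero
        z0 = λ q → z∉ (inj₁ q)
        fz : F z ≡ just w
        fz = trans (sym (Ψ-uncut z0 (λ b → z∉ (inj₂ (proj₁ b))))) Ψz
    in iter-snoc F i {x = v} (Ψ-walk-outside i ez z∉) fz

  onCycle-dec : ∀ x → OnCycle x ⊎ ¬ OnCycle x
  onCycle-dec x with onCycle? x in eq
  ... | true = inj₁ (onCycle?⇒OnCycle eq)
  ... | false = inj₂ (λ c → true≢false (trans (sym (OnCycle⇒onCycle? c)) eq))

  inSpine-dec : ∀ x → InSpine x ⊎ ¬ InSpine x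
  inSpine-dec x with x FP.≟ zero | onCycle-dec x
  ... | yes q | _ = inj₁ (inj₁ q)
  ... | no _ | inj₁ c = inj₁ (inj₂ c)
  ... | no q | inj₂ nc = inj₂ (λ { (inj₁ z) → q z ; (inj₂ c) → nc c })

  -- Along Ψ the cycle maximum never decreases, and it increases at vertex 1 and at cut vertices.
  -- A Ψ-cycle through the spine therefore follows F once round an F-cycle, hence through its cut vertex.
  Ψ-acyclic : ∀ {v} t → iter Ψ (suc t) v ≡ just v → ⊥
  Ψ-acyclic {v} t e with inSpine-dec v
  ... | inj₂ v∉ = v∉ (inj₂ (period⇒OnCycle t (Ψ-walk-outside (suc t) {v} e v∉)))
  ... | inj₁ v∈ = cut-visited v∈
    where
    no-cut : ∀ j z → j < suc t → iter Ψ j v ≡ just z → (z ≡ zero ⊎ CutsCycle z) → ⊥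
    no-cut j z j<t ez q = NP.<-irrefl refl (proj₂ (proj₂ (Ψ-walk-cycleMax (suc t) v∈ e)) j z j<t ez q)
    Ψ≡F-on-walk : ∀ j z → j < suc t → iter Ψ j v ≡ just z → Ψ z ≡ F z
    Ψ≡F-on-walk j z j<t ez = Ψ-uncut (no-cut j z j<t ez ∘ inj₁) (no-cut j z j<t ez ∘ inj₂)
    cut-visited : InSpine v → ⊥
    cut-visited (inj₁ v≡0) = no-cut 0 v (s≤s z≤n) refl (inj₁ v≡0)
    cut-visited (inj₂ cv) =
      let (c , v↝c , _) = cutVertex (cycleMax-IsCycleMax cv)
          (j , j≤t , ej) = reach-within-period F t (Ψ-walk-agrees-F (suc t) e Ψ≡F-on-walk) (reach-trans F (proj₁ (cycleMax-spec v)) v↝c)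
          j≤1+t = NP.≤-trans j≤t (NP.n≤1+n t)
          Ψ-walk = iter-walk Ψ (suc t) j e j≤1+t
          walk≡c = just-injective (trans (sym (Ψ-walk-agrees-F j Ψ-walk (λ i z i<j → Ψ≡F-on-walk i z (NP.<-≤-trans i<j j≤1+t)))) ej)
      in no-cut j _ (s≤s j≤t) (trans Ψ-walk (cong just walk≡c)) (inj₂ (proj₁ (proj₂ (proj₂ (cutVertex (cycleMax-IsCycleMax cv))))))

  Ψ-iter-escapes : ∀ x → iter Ψ N x ≡ nothing
  Ψ-iter-escapes x with iter Ψ N x in eq
  ... | nothing = refl
  ... | just y = let (v , t , c) = iter-just⇒cycle Ψ {x = x} eq in ⊥-elim (Ψ-acyclic t c)

  Ψ≡nothing : ∀ {x} → Ψ x ≡ nothing →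
    (x ≡ zero × nextCycleMax zero ≡ nothing) ⊎ (CutsCycle x × nextCycleMax (cycleMax x) ≡ nothing)
  Ψ≡nothing {x} e with x FP.≟ zero
  ... | yes refl = inj₁ (refl , e)
  ... | no x≢0 with cutsCycle-dec x
  ...   | inj₁ cut = inj₂ (cut , trans (sym (Ψ-cut cut)) e)
  ...   | inj₂ uncut with ≢zero⇒suc x x≢0
  ...     | j , refl = ⊥-elim (just≢nothing (trans (sym (proj₂ (F-suc j))) (trans (sym (Ψ-uncut x≢0 uncut)) e)))

  Ψ-unique-root : ∃[ r ] (Ψ r ≡ nothing × (∀ x → Ψ x ≡ nothing → x ≡ r))
  Ψ-unique-root with greatest N isCycleMax? in eq
  ... | nothing = zero , nextCycleMax-none {zero} (λ d cd _ → no-cycleMax d cd) , root-unique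
    where
    no-cycleMax : ∀ d → IsCycleMax d → ⊥
    no-cycleMax d cd = true≢false (trans (sym (IsCycleMax⇒isCycleMax? cd)) (greatest-nothing N isCycleMax? eq d))
    root-unique : ∀ x → Ψ x ≡ nothing → x ≡ zero
    root-unique x Ψx with Ψ≡nothing {x} Ψx
    ... | inj₁ (x≡0 , _) = x≡0
    ... | inj₂ (cut , _) = ⊥-elim (no-cycleMax _ (cycleMax-IsCycleMax (proj₁ cut)))
  ... | just cM = r , Ψr , root-unique
    where
    top-cycleMax : IsCycleMax cM
    top-cycleMax = isCycleMax?⇒IsCycleMax (proj₁ (greatest-just N isCycleMax? cM eq))
    below-top : ∀ d → IsCycleMax d → toℕ d ≤ toℕ cM
    below-top d cd = proj₂ (greatest-just N isCycleMax? cM eq) d (IsCycleMax⇒isCycleMax? cd)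
    r = proj₁ (cutVertex top-cycleMax)
    r-cut : CutsCycle r
    r-cut = proj₁ (proj₂ (proj₂ (cutVertex top-cycleMax)))
    r-max : cycleMax r ≡ cM
    r-max = proj₂ (proj₂ (proj₂ (cutVertex top-cycleMax)))
    Ψr : Ψ r ≡ nothing
    Ψr = trans (Ψ-cut r-cut) (trans (cong nextCycleMax r-max) (nextCycleMax-none (λ d cd lt → NP.<⇒≱ lt (below-top d cd))))
    root-unique : ∀ x → Ψ x ≡ nothing → x ≡ r
    root-unique x Ψx with Ψ≡nothing {x} Ψx
    ... | inj₁ (refl , none) = ⊥-elim (nextCycleMax-nothing none cM top-cycleMax (≢zero⇒0< (OnCycle⇒≢vertex1 (proj₁ top-cycleMax))))
    ... | inj₂ (cut , none) = cycle-predecessor-unique (proj₁ cut) (proj₁ r-cut) (trans (proj₂ cut) (trans (cong just x-max) (sym (proj₂ r-cut))))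
      where
      x-max : cycleMax x ≡ cycleMax r
      x-max = trans (toℕ-injective (NP.≤-antisym (below-top _ (cycleMax-IsCycleMax (proj₁ cut)))
                                                 (NP.≮⇒≥ (nextCycleMax-nothing none cM top-cycleMax)))) (sym r-max)

  Ψ-rootedTree : isRootedTree Ψ ≡ true
  Ψ-rootedTree = let (r , Ψr , root-unique) = Ψ-unique-root in rootedTree-intro Ψ r Ψr root-unique Ψ-iter-escapes

-- The two maps are mutually inverse

module Φ∘Ψ≗id-Proof (n : ℕ) (f : PMap n) where
  open PfdToTree n f
  open PfdToTreeProperties n f
  open TreeToPfd n Ψ hiding (N)
  open TreeToPfdProperties n Ψ Ψ-rootedTree hiding (onSpine-dec; Φ₀-cyclic)

  cycle-Ψ-reach : ∀ {c u} → IsCycleMax c → Reach F c u → Reach Ψ c u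
  cycle-Ψ-reach {c} (cc , c-max) (s , e) = go s e
    where
    go : ∀ s {u} → iter F s c ≡ just u → Reach Ψ c u
    go zero refl = reach-refl Ψ c
    go (suc s) {u} e with iter-unsnoc F s {x = c} e
    ... | z , ez , Fz with cutsCycle-dec z
    ...   | inj₂ uncut = reach-trans Ψ (go s ez) (reach-edge Ψ (trans (Ψ-uncut (OnCycle⇒≢vertex1 z-cyclic) uncut) Fz))
      where z-cyclic = proj₁ (cycle-closed cc (s , ez))
    ...   | inj₁ cut with trans (sym Fz) (trans (proj₂ cut) (cong just (trans (cycleMax-reach cc (s , ez)) c-max)))
    ...     | refl = reach-refl Ψ c

  cycleMaxBelow? : Fin N → Fin N → Bool
  cycleMaxBelow? c d = isCycleMax? d ∧ (d <F c)

  previousCycleMax : ∀ {c} → IsCycleMax c → nextCycleMax zero ≢ just c →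
    ∃[ c′ ] (IsCycleMax c′ × toℕ c′ < toℕ c × nextCycleMax c′ ≡ just c)
  previousCycleMax {c} cc first≢c with Maybe-cases (nextCycleMax zero)
  ... | inj₁ none = ⊥-elim (nextCycleMax-nothing none c cc (≢zero⇒0< (OnCycle⇒≢vertex1 (proj₁ cc))))
  ... | inj₂ (c₀ , first) with greatest N (cycleMaxBelow? c) in eq
  ...   | nothing = ⊥-elim (true≢false (trans (sym (∧≡true⁺ (IsCycleMax⇒isCycleMax? c₀-max) (<⇒<F {i = c₀} {j = c} c₀<c)))
                                          (greatest-nothing N (cycleMaxBelow? c) eq c₀)))
    where
    c₀-max = proj₁ (nextCycleMax-just {zero} first)
    c₀<c : toℕ c₀ < toℕ c
    c₀<c = NP.≤∧≢⇒< (proj₂ (proj₂ (nextCycleMax-just {zero} first)) c cc (≢zero⇒0< (OnCycle⇒≢vertex1 (proj₁ cc))))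
                    (λ c₀≡c → first≢c (trans first (cong just (toℕ-injective c₀≡c))))
  ...   | just c′ = c′ , isCycleMax?⇒IsCycleMax (proj₁ c′-below) , <F⇒< {i = c′} {j = c} (proj₂ c′-below) ,
                    nextCycleMax-char c cc (<F⇒< {i = c′} {j = c} (proj₂ c′-below)) nothing-between
    where
    c′-below = ∧≡true⁻ {isCycleMax? c′} (proj₁ (greatest-just N (cycleMaxBelow? c) c′ eq))
    nothing-between : ∀ d → IsCycleMax d → toℕ c′ < toℕ d → toℕ c ≤ toℕ d
    nothing-between d cd c′<d = NP.≮⇒≥ λ d<c → NP.<⇒≱ c′<d
      (proj₂ (greatest-just N (cycleMaxBelow? c) c′ eq) d (∧≡true⁺ (IsCycleMax⇒isCycleMax? cd) (<⇒<F {i = d} {j = c} d<c)))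

  vertex1-Ψ-reach-cycleMax : ∀ {c} → IsCycleMax c → Reach Ψ zero c
  vertex1-Ψ-reach-cycleMax {c} cc = go (suc (toℕ c)) cc NP.≤-refl
    where
    go : ∀ k {c} → IsCycleMax c → toℕ c < k → Reach Ψ zero c
    go (suc k) {c} cc c<k with Maybe.≡-dec FP._≟_ (nextCycleMax zero) (just c)
    ... | yes first = reach-edge Ψ first
    ... | no  first≢c =
      let (c′ , cc′ , c′<c , next) = previousCycleMax cc first≢c
          (e , c′↝e , cut , e-max) = cutVertex cc′
      in reach-trans Ψ (go k cc′ (NP.<-≤-trans c′<c (NP.≤-pred c<k)))
           (reach-trans Ψ (cycle-Ψ-reach cc′ c′↝e) (reach-edge Ψ (trans (Ψ-cut cut) (trans (cong nextCycleMax e-max) next))))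

  OnCycle⇒OnSpine : ∀ {x} → OnCycle x → OnSpine x
  OnCycle⇒OnSpine {x} cx = OnCycle⇒≢vertex1 cx , reach-trans Ψ (vertex1-Ψ-reach-cycleMax cm) (cycle-Ψ-reach cm (cycle-reach-back cx (proj₁ (cycleMax-spec x))))
    where cm = cycleMax-IsCycleMax cx

  vertex1-reach⇒InSpine : ∀ {x} → Reach Ψ zero x → InSpine x
  vertex1-reach⇒InSpine r = reach-invariant Ψ InSpine (λ su e → proj₁ (Ψ-step-InSpine su e)) (inj₁ refl) r

  OnSpine⇒OnCycle : ∀ {x} → OnSpine x → OnCycle x
  OnSpine⇒OnCycle (x0 , r) with vertex1-reach⇒InSpine r
  ... | inj₁ q = ⊥-elim (x0 q)
  ... | inj₂ c = c

  segMax≡cycleMax : ∀ {x} → OnSpine x → segMax x ≡ cycleMax x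
  segMax≡cycleMax {x} px = segMax-char (cycleMax x) px
      (OnCycle⇒≢vertex1 (proj₁ cm) , vertex1-Ψ-reach-cycleMax cm , cycle-Ψ-reach cm (cycle-reach-back cx (proj₁ (cycleMax-spec x)))) up
    where
    cx = OnSpine⇒OnCycle px
    cm = cycleMax-IsCycleMax cx
    up : ∀ z → InSegment x z → toℕ z ≤ toℕ (cycleMax x)
    up z (z0 , r0z , (i , e)) =
      NP.≤-trans (≤cycleMax z) (proj₁ (proj₂ (Ψ-walk-cycleMax i (vertex1-reach⇒InSpine r0z) e)))

  parentOrMax-next : ∀ v → parentOrMax (nextCycleMax v) v ≡ v
  parentOrMax-next v with Maybe-cases (nextCycleMax v)
  ... | inj₁ none       rewrite none = refl
  ... | inj₂ (c , next) rewrite next = parentOrMax-≥ (NP.<⇒≤ (proj₁ (proj₂ (nextCycleMax-just next))))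

  Φ₀∘Ψ≗F : ∀ x → Φ₀ x ≡ F x
  Φ₀∘Ψ≗F zero = refl
  Φ₀∘Ψ≗F (suc j) with onCycle-dec (suc j)
  ... | inj₂ nc = trans (Φ₀-offSpine (λ px → nc (OnSpine⇒OnCycle px)) (λ ())) (Ψ-uncut (λ ()) (λ cut → nc (proj₁ cut)))
  ... | inj₁ cx = trans (Φ₀-onSpine px) (trans (cong just succ≡y) (sym Fx))
    where
    x = suc j
    y = proj₁ (F-suc j)
    Fx = proj₂ (F-suc j)
    px = OnCycle⇒OnSpine cx
    max≡ = segMax≡cycleMax px
    succ≡y : parentOrMax (Ψ x) (segMax x) ≡ y
    succ≡y with cutsCycle-dec x
    ... | inj₁ cut = trans (cong (λ m → parentOrMax m (segMax x)) (trans (Ψ-cut cut) (cong nextCycleMax (sym max≡))))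
                       (trans (parentOrMax-next (segMax x)) (trans max≡ (just-injective (trans (sym (proj₂ cut)) Fx))))
    ... | inj₂ uncut = trans (cong (λ m → parentOrMax m (segMax x)) (trans (Ψ-uncut (λ ()) uncut) Fx)) (parentOrMax-< y<max)
      where
      y<max : toℕ y < toℕ (segMax x)
      y<max = subst (λ t → toℕ y < toℕ t) (sym max≡)
        (NP.≤∧≢⇒< (proj₂ (cycleMax-spec x) y (reach-edge F Fx)) (λ q → uncut (cx , trans Fx (cong just (toℕ-injective q)))))

  Φ∘Ψ≗id : ∀ j → Φ j ≡ f j
  Φ∘Ψ≗id j = trans (unshift-cong Φ₀ F Φ₀∘Ψ≗F j) (unshift-shift f j)

module Ψ∘Φ≗id-Proof (n : ℕ) (p : PMap (suc n)) (hT : isRootedTree p ≡ true) where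
  open TreeToPfd n p
  open TreeToPfdProperties n p hT
  open PfdToTree n Φ hiding (N)
  open PfdToTreeProperties n Φ hiding (cycle-reach-back; InSpine)

  Φ₀-suc : ∀ j → ∃[ y ] (Φ₀ (suc j) ≡ just y)
  Φ₀-suc j with onSpine-dec (suc j)
  ... | inj₁ px = spineSucc (suc j) , Φ₀-onSpine px
  ... | inj₂ np = let (y , e) = offSpine-parent np (λ ()) in y , trans (Φ₀-offSpine np (λ ())) e

  F≗Φ₀ : ∀ x → F x ≡ Φ₀ x
  F≗Φ₀ zero = refl
  F≗Φ₀ (suc j) = let (y , e) = Φ₀-suc j in trans (shift-unshift Φ₀ e) (sym e)

  Reach-F⇒Φ₀ : ∀ {x y} → Reach F x y → Reach Φ₀ x y
  Reach-F⇒Φ₀ = reach-cong F Φ₀ F≗Φ₀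

  Reach-Φ₀⇒F : ∀ {x y} → Reach Φ₀ x y → Reach F x y
  Reach-Φ₀⇒F = reach-cong Φ₀ F (λ x → sym (F≗Φ₀ x))

  OnSpine⇒OnCycle : ∀ {x} → OnSpine x → OnCycle x
  OnSpine⇒OnCycle {x} px = spineSucc x , trans (F≗Φ₀ x) (Φ₀-onSpine px) , Reach-Φ₀⇒F (Φ₀-cyclic px (Φ₀-onSpine px))

  OnCycle⇒OnSpine : ∀ {x} → OnCycle x → OnSpine x
  OnCycle⇒OnSpine {x} (y , ey , r) with onSpine-dec x
  ... | inj₁ px = px
  ... | inj₂ np = ⊥-elim (acyclic (trans (sym (Φ₀-offSpine np x0)) (trans (sym (F≗Φ₀ x)) ey)) (offSpine-Reach-Φ₀⇒p np x0 (Reach-F⇒Φ₀ r)))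
    where x0 : x ≢ zero
          x0 = OnCycle⇒≢vertex1 (y , ey , r)

  cycleMax≡segMax : ∀ {x} → OnSpine x → cycleMax x ≡ segMax x
  cycleMax≡segMax {x} px = cycleMax-char (segMax x) (Reach-Φ₀⇒F (Φ₀-reaches-segMax px))
    (λ z r → let (pz , mz) = Φ₀-closed px (Reach-F⇒Φ₀ r) in subst (λ t → toℕ z ≤ toℕ t) mz (≤segMax pz))

  IsCycleMax⇒spineRecord : ∀ {c} → IsCycleMax c → OnSpine c × segMax c ≡ c
  IsCycleMax⇒spineRecord (cc , e) = let pc = OnCycle⇒OnSpine cc in pc , trans (sym (cycleMax≡segMax pc)) e

  spineRecord⇒IsCycleMax : ∀ {c} → OnSpine c → segMax c ≡ c → IsCycleMax c
  spineRecord⇒IsCycleMax pc e = OnSpine⇒OnCycle pc , trans (cycleMax≡segMax pc) e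

  InSegment-vertex1 : ∀ {z} → ¬ InSegment zero z
  InSegment-vertex1 (z≢0 , 0↝z , z↝0) = z≢0 (sym (reach-antisym 0↝z z↝0))

  module _ {x m : Fin N} (0↝x : Reach p zero x) (x≤m : toℕ x ≤ toℕ m) (segment≤m : ∀ z → InSegment x z → toℕ z ≤ toℕ m) where

    cycleMax-above : ∀ d → IsCycleMax d → toℕ m < toℕ d → Reach p x d × d ≢ x
    cycleMax-above d cd m<d with IsCycleMax⇒spineRecord cd
    ... | (d≢0 , 0↝d) , _ with reach-comparable p 0↝d 0↝x
    ...   | inj₁ d↝x = ⊥-elim (NP.<⇒≱ m<d (segment≤m d (d≢0 , 0↝d , d↝x)))
    ...   | inj₂ x↝d = x↝d , λ { refl → NP.<⇒≱ m<d x≤m }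

    nextCycleMax-root : p x ≡ nothing → nextCycleMax m ≡ nothing
    nextCycleMax-root px≡nothing = nextCycleMax-none λ d cd m<d →
      let (x↝d , d≢x) = cycleMax-above d cd m<d in d≢x (sym (reach-from-sink p px≡nothing x↝d))

    nextCycleMax-parent : ∀ {y} → p x ≡ just y → toℕ m < toℕ y → nextCycleMax m ≡ just y
    nextCycleMax-parent {y} e m<y = nextCycleMax-char y (spineRecord⇒IsCycleMax y-onSpine y-record) m<y minimal
      where
      y≢0 : y ≢ zero
      y≢0 refl = NP.<⇒≱ m<y z≤n
      y-onSpine : OnSpine y
      y-onSpine = y≢0 , reach-trans p 0↝x (reach-edge p e)
      y-record : segMax y ≡ y
      y-record = segMax-char y y-onSpine (y≢0 , proj₂ y-onSpine , reach-refl p y) λ z z∈ →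
        case segment-parent 0↝x e z∈ of λ { (inj₁ z∈x) → NP.<⇒≤ (NP.≤-<-trans (segment≤m z z∈x) m<y) ; (inj₂ refl) → NP.≤-refl }
      minimal : ∀ d → IsCycleMax d → toℕ m < toℕ d → toℕ y ≤ toℕ d
      minimal d cd m<d with cycleMax-above d cd m<d | IsCycleMax⇒spineRecord cd
      ... | x↝d , d≢x | d-onSpine , d-record with reach-uncons p x↝d
      ...   | inj₁ x≡d = ⊥-elim (d≢x (sym x≡d))
      ...   | inj₂ (w , ew , w↝d) with trans (sym e) ew
      ...     | refl = subst (λ t → toℕ y ≤ toℕ t) d-record (proj₂ (segMax-spec d-onSpine) y (y≢0 , proj₂ y-onSpine , w↝d))

  nextCycleMax-segMax : ∀ {x} → OnSpine x → spineSucc x ≡ segMax x → nextCycleMax (segMax x) ≡ p x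
  nextCycleMax-segMax {x} px at-record with spineSucc-cases px
  ... | inj₁ (y , e , y<max , succ≡y) = ⊥-elim (NP.<-irrefl (cong toℕ (trans (sym succ≡y) at-record)) y<max)
  ... | inj₂ (_ , inj₁ e) = trans (nextCycleMax-root (proj₂ px) (≤segMax px) (proj₂ (segMax-spec px)) e) (sym e)
  ... | inj₂ (_ , inj₂ (y , e , max≤y)) =
    trans (nextCycleMax-parent (proj₂ px) (≤segMax px) (proj₂ (segMax-spec px)) e (NP.≤∧≢⇒< max≤y max≢y)) (sym e)
    where
    max≢y : toℕ (segMax x) ≢ toℕ y
    max≢y q = acyclic e (subst (λ t → Reach p t x) (toℕ-injective q) (segMax-reaches px))

  Ψ∘Φ≗id : ∀ x → Ψ x ≡ p x
  Ψ∘Φ≗id zero with Maybe-cases (p zero)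
  ... | inj₁ e       = trans (nextCycleMax-root (reach-refl p zero) NP.≤-refl (λ z → ⊥-elim ∘ InSegment-vertex1) e) (sym e)
  ... | inj₂ (y , e) = trans (nextCycleMax-parent (reach-refl p zero) NP.≤-refl (λ z → ⊥-elim ∘ InSegment-vertex1) e
                               (≢zero⇒0< λ { refl → no-loop e })) (sym e)
  Ψ∘Φ≗id (suc j) with onSpine-dec (suc j)
  ... | inj₂ np = trans (Ψ-uncut (λ ()) (λ cut → np (OnCycle⇒OnSpine (proj₁ cut)))) (trans (F≗Φ₀ (suc j)) (Φ₀-offSpine np (λ ())))
  ... | inj₁ px with spineSucc (suc j) FP.≟ segMax (suc j)
  ...   | yes at-record = trans (Ψ-cut cut) (trans (cong nextCycleMax (cycleMax≡segMax px)) (nextCycleMax-segMax px at-record))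
    where
    cut : CutsCycle (suc j)
    cut = OnSpine⇒OnCycle px , trans (F≗Φ₀ (suc j)) (trans (Φ₀-onSpine px) (cong just (trans at-record (sym (cycleMax≡segMax px)))))
  ...   | no ¬at-record = trans (Ψ-uncut (λ ()) uncut) (trans (F≗Φ₀ (suc j)) (trans (Φ₀-onSpine px) succ≡parent))
    where
    uncut : ¬ CutsCycle (suc j)
    uncut (_ , e) = ¬at-record (just-injective (trans (sym (trans (F≗Φ₀ (suc j)) (Φ₀-onSpine px))) (trans e (cong just (cycleMax≡segMax px)))))
    succ≡parent : just (spineSucc (suc j)) ≡ p (suc j)
    succ≡parent with spineSucc-cases px
    ... | inj₁ (y , e , _ , succ≡y) = trans (cong just succ≡y) (sym e)
    ... | inj₂ (succ≡max , _)       = ⊥-elim (¬at-record succ≡max)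

-- Invariance under pointwise equality

module _ {n : ℕ} {p q : PMap (suc n)} (p≗q : p ≗ q) where
  private
    N = suc n
    module P = TreeToPfd n p
    module Q = TreeToPfd n q

  improperAt-cong : improperAt p ≗ improperAt q
  improperAt-cong x with Maybe-cases (p x)
  ... | inj₁ e       = trans (improperAt-root p e) (sym (improperAt-root q (trans (sym (p≗q x)) e)))
  ... | inj₂ (i , e) = trans (improperAt-child p e)
    (trans (anyFin-cong N (λ d → cong (_∧ (d <F i)) (reachWithin-cong p q p≗q N d x)))
           (sym (improperAt-child q (trans (sym (p≗q x)) e))))

  properAt-cong : properAt p ≗ properAt q
  properAt-cong x with Maybe-cases (p x)
  ... | inj₁ e       = trans (properAt-root p e) (sym (properAt-root q (trans (sym (p≗q x)) e)))
  ... | inj₂ (i , e) = trans (properAt-child p e)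
    (trans (cong not (improperAt-cong x)) (sym (properAt-child q (trans (sym (p≗q x)) e))))

  isRootedTree-cong : isRootedTree p ≡ isRootedTree q
  isRootedTree-cong = cong₂ _∧_ (cong (_≡ᵇ 1) (countFin-cong N (cong isNothing ∘ p≗q)))
    (allFin?-cong N (cong isNothing ∘ iter-cong p q p≗q N))

  childrenOf1-cong : childrenOf1 p ≡ childrenOf1 q
  childrenOf1-cong = countFin-cong N (cong (isJustAt zero) ∘ p≗q)

  treeImprope-cong : treeImprope p ≡ treeImprope q
  treeImprope-cong = countFin-cong N improperAt-cong

  treePrope-cong : treePrope p ≡ treePrope q
  treePrope-cong = countFin-cong N properAt-cong

  onSpine?-cong : P.onSpine? ≗ Q.onSpine?
  onSpine?-cong x = cong (isNotVertex1 x ∧_) (reachWithin-cong p q p≗q N zero x)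

  segMax-cong : P.segMax ≗ Q.segMax
  segMax-cong x = cong (fromMaybe x) (greatest-cong N λ z →
    cong (isNotVertex1 z ∧_) (cong₂ _∧_ (reachWithin-cong p q p≗q N zero z) (reachWithin-cong p q p≗q N z x)))

  Φ₀-cong : P.Φ₀ ≗ Q.Φ₀
  Φ₀-cong x rewrite onSpine?-cong x | p≗q x | segMax-cong x = refl

  Φ-cong : P.Φ ≗ Q.Φ
  Φ-cong = unshift-cong P.Φ₀ Q.Φ₀ Φ₀-cong

module _ {n : ℕ} {f g : PMap n} (f≗g : f ≗ g) where
  private
    N = suc n
    module F = PfdToTree n f
    module G = PfdToTree n g

  pfdImproperAt-cong : pfdImproperAt f ≗ pfdImproperAt g
  pfdImproperAt-cong x with Maybe-cases (f x)
  ... | inj₁ e       = trans (pfdImproperAt-sink f e) (sym (pfdImproperAt-sink g (trans (sym (f≗g x)) e)))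
  ... | inj₂ (i , e) = trans (pfdImproperAt-edge f e)
    (trans (anyFin-cong n (λ d → cong (_∧ (d ≤F i)) (reachWithin-cong f g f≗g n d x)))
           (sym (pfdImproperAt-edge g (trans (sym (f≗g x)) e))))

  pfdProperAt-cong : pfdProperAt f ≗ pfdProperAt g
  pfdProperAt-cong x with Maybe-cases (f x)
  ... | inj₁ e       = trans (pfdProperAt-sink f e) (sym (pfdProperAt-sink g (trans (sym (f≗g x)) e)))
  ... | inj₂ (i , e) = trans (pfdProperAt-edge f e)
    (trans (cong not (pfdImproperAt-cong x)) (sym (pfdProperAt-edge g (trans (sym (f≗g x)) e))))

  outDeg0-cong : outDeg0 f ≡ outDeg0 g
  outDeg0-cong = countFin-cong n (cong isNothing ∘ f≗g)

  pfdImprope-cong : pfdImprope f ≡ pfdImprope g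
  pfdImprope-cong = countFin-cong n pfdImproperAt-cong

  pfdPrope-cong : pfdPrope f ≡ pfdPrope g
  pfdPrope-cong = countFin-cong n pfdProperAt-cong

  shift-cong : shift f ≗ shift g
  shift-cong zero    = refl
  shift-cong (suc j) = cong shiftTarget (f≗g j)

  reaches?-shift-cong : ∀ x y → reaches? (shift f) x y ≡ reaches? (shift g) x y
  reaches?-shift-cong = reachWithin-cong (shift f) (shift g) shift-cong N

  onCycle?-cong : F.onCycle? ≗ G.onCycle?
  onCycle?-cong x with shift f x | shift g x | shift-cong x
  ... | nothing | _ | refl = refl
  ... | just y  | _ | refl = reaches?-shift-cong y x

  cycleMax-cong : F.cycleMax ≗ G.cycleMax
  cycleMax-cong x = cong (fromMaybe x) (greatest-cong N (reaches?-shift-cong x))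

  nextCycleMax-cong : F.nextCycleMax ≗ G.nextCycleMax
  nextCycleMax-cong v = least-cong N λ c →
    cong (_∧ (v <F c)) (cong₂ _∧_ (onCycle?-cong c) (cong (λ t → eqFin t c) (cycleMax-cong c)))

  Ψ-cong : F.Ψ ≗ G.Ψ
  Ψ-cong x rewrite nextCycleMax-cong zero | onCycle?-cong x | cycleMax-cong x | shift-cong x
                 | nextCycleMax-cong (G.cycleMax x) = refl

-- Counting functions through a correspondence

∈-++-drop : ∀ {x y : A} ys zs → y ∈ ys ++ x ∷ zs → y ≢ x → y ∈ ys ++ zs
∈-++-drop []       zs (here refl) y≢x = contradiction refl y≢x
∈-++-drop []       zs (there y∈) y≢x = y∈
∈-++-drop (w ∷ ys) zs (here refl) y≢x = here refl
∈-++-drop (w ∷ ys) zs (there y∈) y≢x = there (∈-++-drop ys zs y∈ y≢x)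

Unique-⊆⇒length-≤ : {xs ys : List A} → Unique xs → xs ⊆ ys → length xs ≤ length ys
Unique-⊆⇒length-≤ [] xs⊆ys = z≤n
Unique-⊆⇒length-≤ {xs = x ∷ xs} (x≢xs ∷ uxs) xs⊆ys with ∈-∃++ (xs⊆ys (here refl))
... | ys₁ , ys₂ , refl = begin
  suc (length xs)         ≤⟨ s≤s (Unique-⊆⇒length-≤ uxs tail⊆) ⟩
  suc (length (ys₁ ++ ys₂)) ≡⟨ cong suc (length-++ ys₁) ⟩
  suc (length ys₁ ℕ.+ length ys₂) ≡⟨ NP.+-suc (length ys₁) (length ys₂) ⟨
  length ys₁ ℕ.+ length (x ∷ ys₂) ≡⟨ length-++ ys₁ ⟨
  length (ys₁ ++ x ∷ ys₂) ∎
  where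
  open NP.≤-Reasoning
  tail⊆ : xs ⊆ ys₁ ++ ys₂
  tail⊆ {y} y∈xs = ∈-++-drop ys₁ ys₂ (xs⊆ys (there y∈xs)) (λ y≡x → All.lookup x≢xs y∈xs (sym y≡x))

Unique-map : (f : A → B) {xs : List A} → Unique xs →
             (∀ {x y} → x ∈ xs → y ∈ xs → f x ≡ f y → x ≡ y) → Unique (map f xs)
Unique-map f [] f-inj = []
Unique-map f {x ∷ xs} (x≢xs ∷ uxs) f-inj =
  All.map⁺ (All.tabulate λ {y} y∈xs fx≡fy → All.lookup x≢xs y∈xs (f-inj (here refl) (there y∈xs) fx≡fy))
  ∷ Unique-map f uxs (λ x∈ y∈ → f-inj (there x∈) (there y∈))
  where import Data.List.Relation.Unary.All.Properties as All

filterᵇ-length-≤ : (P : A → Bool) (Q : B → Bool) (f : A → B) {xs : List A} {ys : List B} →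
  Unique xs → (∀ y → y ∈ ys) →
  (∀ x → T (P x) → T (Q (f x))) →
  (∀ {x y} → T (P x) → T (P y) → f x ≡ f y → x ≡ y) →
  length (filterᵇ P xs) ≤ length (filterᵇ Q ys)
filterᵇ-length-≤ P Q f {xs} {ys} uxs complete pres inj =
  subst (_≤ length (filterᵇ Q ys)) (length-map f (filterᵇ P xs))
    (Unique-⊆⇒length-≤ (Unique-map f (Unique.filter⁺ (T? ∘ P) uxs) (λ x∈ y∈ → inj (P-of x∈) (P-of y∈))) image⊆)
  where
  P-of : ∀ {x} → x ∈ filterᵇ P xs → T (P x)
  P-of x∈ = proj₂ (∈-filter⁻ (T? ∘ P) {xs = xs} x∈)
  image⊆ : map f (filterᵇ P xs) ⊆ filterᵇ Q ys
  image⊆ y∈ with ∈-map⁻ f y∈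
  ... | x , x∈ , refl = ∈-filter⁺ (T? ∘ Q) (complete (f x)) (pres x (P-of x∈))

allVecs : (m : ℕ) → List A → List (Vec A m)
allVecs zero    xs = [ [] ]
allVecs (suc m) xs = concatMap (λ a → map (a ∷_) (allVecs m xs)) xs

allVecs-complete : (xs : List A) → (∀ a → a ∈ xs) → (v : Vec A m) → v ∈ allVecs m xs
allVecs-complete xs complete []      = here refl
allVecs-complete {m = suc m} xs complete (a ∷ v) = go xs (complete a)
  where
  go : ∀ ys → a ∈ ys → a ∷ v ∈ concatMap (λ b → map (b ∷_) (allVecs m xs)) ys
  go (y ∷ ys) (here refl) = ∈-++⁺ˡ (∈-map⁺ (a ∷_) (allVecs-complete xs complete v))
  go (y ∷ ys) (there a∈)  = ∈-++⁺ʳ (map (y ∷_) (allVecs m xs)) (go ys a∈)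

allVecs-unique : (xs : List A) → Unique xs → Unique (allVecs m xs)
allVecs-unique {m = zero}  xs uxs = [] ∷ []
allVecs-unique {A} {m = suc m} xs uxs = go xs uxs
  where
  cons-inj : ∀ {y} {v w : Vec A m} → y ∷ v ≡ y ∷ w → v ≡ w
  cons-inj refl = refl
  head∈ : ∀ {b} {v : Vec A m} ys → b ∷ v ∈ concatMap (λ c → map (c ∷_) (allVecs m xs)) ys → b ∈ ys
  head∈ (y ∷ ys) bv∈ with ∈-++⁻ (map (y ∷_) (allVecs m xs)) bv∈
  ... | inj₂ bv∈′ = there (head∈ ys bv∈′)
  ... | inj₁ bv∈′ with ∈-map⁻ (y ∷_) bv∈′
  ...   | _ , _ , refl = here refl
  go : ∀ ys → Unique ys → Unique (concatMap (λ c → map (c ∷_) (allVecs m xs)) ys)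
  go []       []            = []
  go (y ∷ ys) (y≢ys ∷ uys) = Unique.++⁺ (Unique.map⁺ cons-inj (allVecs-unique xs uxs)) (go ys uys) disjoint
    where
    disjoint : ∀ {v} → v ∈ map (y ∷_) (allVecs m xs) × v ∈ concatMap (λ c → map (c ∷_) (allVecs m xs)) ys → ⊥
    disjoint (v∈₁ , v∈₂) with ∈-map⁻ (y ∷_) v∈₁
    ... | _ , _ , refl = All.lookup y≢ys (head∈ ys v∈₂) refl

allFuns≗allVecs : (m : ℕ) (xs : List A) →
  Pointwise (λ f v → f ≗ lookup v) (allFuns m xs) (allVecs m xs)
allFuns≗allVecs zero    xs = (λ ()) ∷ []
allFuns≗allVecs (suc m) xs = go xs
  where
  go : ∀ ys → Pointwise (λ f v → f ≗ lookup v)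
                (concatMap (λ a → map (a VF.∷_) (allFuns m xs)) ys)
                (concatMap (λ a → map (a ∷_) (allVecs m xs)) ys)
  go []       = []
  go (y ∷ ys) = Pointwise.++⁺
    (Pointwise.map⁺ (y VF.∷_) (y ∷_) (Pointwise.map (λ { f≗v zero → refl ; f≗v (suc i) → f≗v i }) (allFuns≗allVecs m xs)))
    (go ys)

Respects≗ : ((Fin m → A) → Bool) → Set
Respects≗ P = ∀ {f g} → f ≗ g → P f ≡ P g

count-allFuns≡count-allVecs : (P : (Fin m → A) → Bool) → Respects≗ P → (xs : List A) →
  length (filterᵇ P (allFuns m xs)) ≡ length (filterᵇ (P ∘ lookup) (allVecs m xs))
count-allFuns≡count-allVecs {m = m} P P-resp xs = Pointwise-length
  (Pointwise.filter⁺ (T? ∘ P) (T? ∘ P ∘ lookup) (λ f≗v → subst T (P-resp f≗v)) (λ f≗v → subst T (sym (P-resp f≗v)))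
    (allFuns≗allVecs m xs))

module _ {m m′ : ℕ} {A B : Set} (xs : List A) (ys : List B) where

  count-≤ : (P : (Fin m → A) → Bool) (Q : (Fin m′ → B) → Bool) → Respects≗ P → Respects≗ Q →
    Unique xs → (∀ b → b ∈ ys) →
    (to : (Fin m → A) → (Fin m′ → B)) (from : (Fin m′ → B) → (Fin m → A)) →
    (∀ {g h} → g ≗ h → from g ≗ from h) →
    (∀ f → P f ≡ true → Q (to f) ≡ true) →
    (∀ f → P f ≡ true → from (to f) ≗ f) →
    length (filterᵇ P (allFuns m xs)) ≤ length (filterᵇ Q (allFuns m′ ys))
  count-≤ P Q P-resp Q-resp uxs complete to from from-cong to-pres from∘to =
    subst₂ _≤_ (sym (count-allFuns≡count-allVecs P P-resp xs)) (sym (count-allFuns≡count-allVecs Q Q-resp ys))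
      (filterᵇ-length-≤ (P ∘ lookup) (Q ∘ lookup) toᵛ (allVecs-unique xs uxs) (allVecs-complete ys complete)
        (λ u Pu → ≡true⇒T (trans (Q-resp (lookup∘tabulate _)) (to-pres (lookup u) (T⇒≡true Pu))))
        inj)
    where
    toᵛ : Vec A m → Vec B m′
    toᵛ u = Vec.tabulate (to (lookup u))
    inj : ∀ {u v} → T (P (lookup u)) → T (P (lookup v)) → toᵛ u ≡ toᵛ v → u ≡ v
    inj {u} {v} Pu Pv eq = begin
      u                           ≡⟨ tabulate∘lookup u ⟨
      Vec.tabulate (lookup u)      ≡⟨ tabulate-cong lookup-u≗v ⟩
      Vec.tabulate (lookup v)      ≡⟨ tabulate∘lookup v ⟩
      v ∎
      where
      open ≡-Reasoning
      to≗ : to (lookup u) ≗ to (lookup v)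
      to≗ i = trans (sym (lookup∘tabulate _ i)) (trans (cong (λ w → lookup w i) eq) (lookup∘tabulate _ i))
      lookup-u≗v : lookup u ≗ lookup v
      lookup-u≗v i = trans (sym (from∘to _ (T⇒≡true Pu) i)) (trans (from-cong to≗ i) (from∘to _ (T⇒≡true Pv) i))

record Correspondence {m m′ : ℕ} {A B : Set} (P : (Fin m → A) → Bool) (Q : (Fin m′ → B) → Bool) : Set where
  field
    to              : (Fin m → A) → (Fin m′ → B)
    from            : (Fin m′ → B) → (Fin m → A)
    to-cong         : ∀ {f g} → f ≗ g → to f ≗ to g
    from-cong       : ∀ {f g} → f ≗ g → from f ≗ from g
    to-preserves    : ∀ f → P f ≡ true → Q (to f) ≡ true
    from-preserves  : ∀ g → Q g ≡ true → P (from g) ≡ true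
    from∘to         : ∀ f → P f ≡ true → from (to f) ≗ f
    to∘from         : ∀ g → Q g ≡ true → to (from g) ≗ g

count-≡ : {m m′ : ℕ} {xs : List A} {ys : List B} {P : (Fin m → A) → Bool} {Q : (Fin m′ → B) → Bool} →
  Unique xs → Unique ys → (∀ a → a ∈ xs) → (∀ b → b ∈ ys) → Respects≗ P → Respects≗ Q →
  Correspondence P Q → length (filterᵇ P (allFuns m xs)) ≡ length (filterᵇ Q (allFuns m′ ys))
count-≡ {xs = xs} {ys} {P} {Q} uxs uys cxs cys P-resp Q-resp c = NP.≤-antisym
  (count-≤ xs ys P Q P-resp Q-resp uxs cys to from from-cong to-preserves from∘to)
  (count-≤ ys xs Q P Q-resp P-resp uys cxs from to to-cong from-preserves to∘from)
  where open Correspondence c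

allMaybeFin-unique : ∀ N → Unique (allMaybeFin N)
allMaybeFin-unique N = All.tabulate nothing≢ ∷ Unique.map⁺ just-injective (Unique.tabulate⁺ id)
  where
  nothing≢ : ∀ {x} → x ∈ map just (allFin N) → nothing ≢ x
  nothing≢ x∈ nothing≡x with ∈-map⁻ just x∈
  ... | _ , _ , refl = case nothing≡x of λ ()

allMaybeFin-complete : ∀ N (x : Maybe (Fin N)) → x ∈ allMaybeFin N
allMaybeFin-complete N nothing  = here refl
allMaybeFin-complete N (just i) = there (∈-map⁺ just (∈-allFin i))

module _ (n k a b : ℕ) where

  countedTree? : PMap (suc n) → Bool
  countedTree? p = isRootedTree p ∧ (childrenOf1 p ≡ᵇ k) ∧ (treeImprope p ≡ᵇ a) ∧ (treePrope p ≡ᵇ (b + k))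

  countedPfd? : PMap n → Bool
  countedPfd? f = (outDeg0 f ≡ᵇ k) ∧ (pfdImprope f ≡ᵇ a) ∧ (pfdPrope f ≡ᵇ b)

  countedTree?-cong : Respects≗ countedTree?
  countedTree?-cong h = cong₂ _∧_ (isRootedTree-cong h) (cong₂ _∧_ (cong (_≡ᵇ k) (childrenOf1-cong h))
    (cong₂ _∧_ (cong (_≡ᵇ a) (treeImprope-cong h)) (cong (_≡ᵇ b + k) (treePrope-cong h))))

  countedPfd?-cong : Respects≗ countedPfd?
  countedPfd?-cong h = cong₂ _∧_ (cong (_≡ᵇ k) (outDeg0-cong h))
    (cong₂ _∧_ (cong (_≡ᵇ a) (pfdImprope-cong h)) (cong (_≡ᵇ b) (pfdPrope-cong h)))

  tree-pfd-correspondence : Correspondence countedTree? countedPfd?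
  tree-pfd-correspondence = record
    { to = λ p → TreeToPfd.Φ n p
    ; from = λ f → PfdToTree.Ψ n f
    ; to-cong = Φ-cong
    ; from-cong = Ψ-cong
    ; to-preserves = λ p P → trans (sym (condition-Φ p (isRootedTree-of p P))) P
    ; from-preserves = λ f Q → trans (condition-Φ (PfdToTree.Ψ n f) (PfdToTreeProperties.Ψ-rootedTree n f))
                                 (trans (countedPfd?-cong (Φ∘Ψ≗id-Proof.Φ∘Ψ≗id n f)) Q)
    ; from∘to = λ p P → Ψ∘Φ≗id-Proof.Ψ∘Φ≗id n p (isRootedTree-of p P)
    ; to∘from = λ f _ → Φ∘Ψ≗id-Proof.Φ∘Ψ≗id n f
    }
    where
    isRootedTree-of : ∀ p → countedTree? p ≡ true → isRootedTree p ≡ true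
    isRootedTree-of p e = proj₁ (∧≡true⁻ {isRootedTree p} e)
    condition-Φ : ∀ p → isRootedTree p ≡ true → countedTree? p ≡ countedPfd? (TreeToPfd.Φ n p)
    condition-Φ p hT = TreeToPfdStatistics.counting-condition n p hT k a b

proposition1p5 : (n k : ℕ) → k ≤ n → (a b : ℕ) → tCoeff n k a b ≡ tTildeCoeff n k a b
-- The correspondence does not need k ≤ n.
proposition1p5 n k _ a b = count-≡ (allMaybeFin-unique (suc n)) (allMaybeFin-unique n)
  (allMaybeFin-complete (suc n)) (allMaybeFin-complete n)
  (countedTree?-cong n k a b) (countedPfd?-cong n k a b) (tree-pfd-correspondence n k a b)
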